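{- Let $\mathbb{L}$ be one of the logics $\mathbb{PCL},\mathbb{PN},\mathbb{PT},\mathbb{PW},\mathbb{PC},\mathbb{PU},\mathbb{PNU},\mathbb{PTU},\mathbb{PWU},\mathbb{PCU},\mathbb{PA},\mathbb{PNA},\mathbb{PTA},\mathbb{PWA},\mathbb{PCA}$ and let $\mathbf{K}$ be its corresponding labelled calculus ($\mathbf{CL}$ for $\mathbb{PCL}$, and $\mathbf{CL^{S}}$ for $\mathbb{PS}$ where $S$ is the string of letters after P, e.g. $\mathbf{CL^{TU}}$ for $\mathbb{PTU}$). If a formula $A$ is derivable in the axiom system of $\mathbb{L}$, then for any world label $x$ the sequent $\Rightarrow x:A$ is derivable in $\mathbf{K}$.
   Context: Formulas of $\mathcal{L}$: built from atoms and $\bot$ by $\wedge,\vee,\rightarrow,>$; $\neg A:=A\rightarrow\bot$, $\top:=\neg\bot$. Axiom system of $\mathbb{PCL}$: classical propositional tautologies, modus ponens, rules (RCEA) from $A\leftrightarrow B$ infer $(A>C)\leftrightarrow(B>C)$ and (RCK) from $A\rightarrow B$ infer $(C>A)\rightarrow(C>B)$, axioms (ID) $A>A$, (R-And) $(A>B)\wedge(A>C)\rightarrow(A>(B\wedge C))$, (CM) $(A>B)\wedge(A>C)\rightarrow((A\wedge B)>C)$, (OR) $(A>C)\wedge(B>C)\rightarrow((A\vee B)>C)$. Extra axioms: (N) $\neg(\top>\bot)$; (T) $A\rightarrow\neg(A>\bot)$; (W) $(A>B)\rightarrow(A\rightarrow B)$; (C) $(A\wedge B)\rightarrow(A>B)$;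 (U$_1$) $(\neg A>\bot)\rightarrow(\neg(\neg A>\bot)>\bot)$; (U$_2$) $\neg(A>\bot)\rightarrow((A>\bot)>\bot)$; (A$_1$) $(A>B)\rightarrow(C>(A>B))$; (A$_2$) $\neg(A>B)\rightarrow(C>\neg(A>B))$. $\mathbb{PN}=\mathbb{PCL}$+(N), $\mathbb{PT}=\mathbb{PN}$+(T), $\mathbb{PW}=\mathbb{PT}$+(W), $\mathbb{PC}=\mathbb{PW}$+(C); $\mathbb{PU}=\mathbb{PCL}$+(U$_1$)+(U$_2$) and $\mathbb{PNU},\mathbb{PTU},\mathbb{PWU},\mathbb{PCU}$ successively add (N),(T),(W),(C); $\mathbb{PA}=\mathbb{PCL}$+(A$_1$)+(A$_2$) and $\mathbb{PNA},\mathbb{PTA},\mathbb{PWA},\mathbb{PCA}$ successively add (N),(T),(W),(C). Labelled calculi: world labels $x,y,z,\dots$; neighbourhood labels $a,b,c,\dots$, and $\{x\}$ for each world label $x$. Relational atoms $a\in N(x)$, $x\in a$, $a\subseteq b$; labelled formulas: relational atoms, $x:A$, $a\Vdash^\exists A$, $a\Vdash^\forall A$, $x\Vdash_a A|B$. Sequents $\Gamma\Rightarrow\Delta$ of multisets, relational atoms only in $\Gamma$. Rules written premiss(es) / conclusion; "($u$ fresh)": $u$ not in conclusion. $\mathbf{CL}$: initial sequents $x:p,\Gamma\Rightarrow\Delta,x:p$ ($p$ atom), $x:\bot,\Gamma\Rightarrow\Delta$; L$\wedge$: $x:A,x:B,\Gamma\Rightarrow\Delta$ / $x:A\wedge B,\Gamma\Rightarrow\Delta$;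 R$\wedge$: $\Gamma\Rightarrow\Delta,x:A$ and $\Gamma\Rightarrow\Delta,x:B$ / $\Gamma\Rightarrow\Delta,x:A\wedge B$; L$\vee$: $x:A,\Gamma\Rightarrow\Delta$ and $x:B,\Gamma\Rightarrow\Delta$ / $x:A\vee B,\Gamma\Rightarrow\Delta$; R$\vee$: $\Gamma\Rightarrow\Delta,x:A,x:B$ / $\Gamma\Rightarrow\Delta,x:A\vee B$; L$\rightarrow$: $\Gamma\Rightarrow\Delta,x:A$ and $x:B,\Gamma\Rightarrow\Delta$ / $x:A\rightarrow B,\Gamma\Rightarrow\Delta$; R$\rightarrow$: $x:A,\Gamma\Rightarrow\Delta,x:B$ / $\Gamma\Rightarrow\Delta,x:A\rightarrow B$; L$\forall$: $x:A,x\in a,a\Vdash^\forall A,\Gamma\Rightarrow\Delta$ / $x\in a,a\Vdash^\forall A,\Gamma\Rightarrow\Delta$; R$\forall$ ($x$ fresh): $x\in a,\Gamma\Rightarrow\Delta,x:A$ / $\Gamma\Rightarrow\Delta,a\Vdash^\forall A$; L$\exists$ ($x$ fresh): $x\in a,x:A,\Gamma\Rightarrow\Delta$ / $a\Vdash^\exists A,\Gamma\Rightarrow\Delta$; R$\exists$: $x\in a,\Gamma\Rightarrow\Delta,x:A,a\Vdash^\exists A$ / $x\in a,\Gamma\Rightarrow\Delta,a\Vdash^\exists A$; R$>$ ($a$ fresh): $a\in N(x),a\Vdash^\exists A,\Gamma\Rightarrow\Delta,x\Vdash_a A|B$ / $\Gamma\Rightarrow\Delta,x:A>B$; L$>$: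 $a\in N(x),x:A>B,\Gamma\Rightarrow\Delta,a\Vdash^\exists A$ and $x\Vdash_a A|B,a\in N(x),x:A>B,\Gamma\Rightarrow\Delta$ / $a\in N(x),x:A>B,\Gamma\Rightarrow\Delta$; R$|$: $c\in N(x),c\subseteq a,\Gamma\Rightarrow\Delta,x\Vdash_a A|B,c\Vdash^\exists A$ and $c\in N(x),c\subseteq a,\Gamma\Rightarrow\Delta,x\Vdash_a A|B,c\Vdash^\forall A\rightarrow B$ / $c\in N(x),c\subseteq a,\Gamma\Rightarrow\Delta,x\Vdash_a A|B$; L$|$ ($c$ fresh): $c\in N(x),c\subseteq a,c\Vdash^\exists A,c\Vdash^\forall A\rightarrow B,\Gamma\Rightarrow\Delta$ / $x\Vdash_a A|B,\Gamma\Rightarrow\Delta$; Ref: $a\subseteq a,\Gamma\Rightarrow\Delta$ / $\Gamma\Rightarrow\Delta$; Tr: $c\subseteq a,c\subseteq b,b\subseteq a,\Gamma\Rightarrow\Delta$ / $c\subseteq b,b\subseteq a,\Gamma\Rightarrow\Delta$; L$\subseteq$: $x\in a,a\subseteq b,x\in b,\Gamma\Rightarrow\Delta$ / $x\in a,a\subseteq b,\Gamma\Rightarrow\Delta$. Extension rules: N ($a$ fresh): $a\in N(x),\Gamma\Rightarrow\Delta$ / $\Gamma\Rightarrow\Delta$; 0 ($y$ fresh): $y\in a,a\in N(x),\Gamma\Rightarrow\Delta$ / $a\in N(x),\Gamma\Rightarrow\Delta$; T ($a$ fresh): $x\in a,a\in N(x),\Gamma\Rightarrow\Delta$ / $\Gamma\Rightarrow\Delta$;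 W: $x\in a,a\in N(x),\Gamma\Rightarrow\Delta$ / $a\in N(x),\Gamma\Rightarrow\Delta$; Single: $x\in\{x\},\{x\}\in N(x),\Gamma\Rightarrow\Delta$ / $\{x\}\in N(x),\Gamma\Rightarrow\Delta$; C: $\{x\}\in N(x),\{x\}\subseteq a,a\in N(x),\Gamma\Rightarrow\Delta$ / $a\in N(x),\Gamma\Rightarrow\Delta$; Repl$_1$: $y\in\{x\},At(x),At(y),\Gamma\Rightarrow\Delta$ / $y\in\{x\},At(x),\Gamma\Rightarrow\Delta$; Repl$_2$: $y\in\{x\},At(x),At(y),\Gamma\Rightarrow\Delta$ / $y\in\{x\},At(y),\Gamma\Rightarrow\Delta$, with $At(x)$ one of $x:P$ ($P$ atom), $x\in a$, $a\in N(x)$, $x\in\{z\}$, and $At(y)$ replacing $x$ by $y$; U$_1$ ($c$ fresh): $z\in c,c\in N(x),a\in N(x),y\in a,b\in N(y),z\in b,\Gamma\Rightarrow\Delta$ / $a\in N(x),y\in a,b\in N(y),z\in b,\Gamma\Rightarrow\Delta$; U$_2$ ($c$ fresh): $z\in c,c\in N(y),a\in N(x),y\in a,b\in N(x),z\in b,\Gamma\Rightarrow\Delta$ / $a\in N(x),y\in a,b\in N(x),z\in b,\Gamma\Rightarrow\Delta$; A$_1$: $b\in N(y),a\in N(x),y\in a,b\in N(x),\Gamma\Rightarrow\Delta$ / $a\in N(x),y\in a,b\in N(x),\Gamma\Rightarrow\Delta$; A$_2$: $b\in N(x),a\in N(x),y\in a,b\in N(y),\Gamma\Rightarrow\Delta$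 / $a\in N(x),y\in a,b\in N(y),\Gamma\Rightarrow\Delta$; plus instances of U$_1$,U$_2$,A$_1$,A$_2$ with coinciding principal atoms of the conclusion written once. Calculi: $\mathbf{CL^N}=\mathbf{CL}$+N+0; $\mathbf{CL^T}=\mathbf{CL^N}$+T; $\mathbf{CL^W}=\mathbf{CL^T}$+W; $\mathbf{CL^C}=\mathbf{CL^W}$+C+Single+Repl$_1$+Repl$_2$; $\mathbf{CL^U}=\mathbf{CL}$+U$_1$+U$_2$; $\mathbf{CL^{NU}},\mathbf{CL^{TU}},\mathbf{CL^{WU}},\mathbf{CL^{CU}}$ are $\mathbf{CL^N},\mathbf{CL^T},\mathbf{CL^W},\mathbf{CL^C}$ plus U$_1$,U$_2$; $\mathbf{CL^A}=\mathbf{CL}$+A$_1$+A$_2$; $\mathbf{CL^{NA}},\dots,\mathbf{CL^{CA}}$ are $\mathbf{CL^N},\dots,\mathbf{CL^C}$ plus A$_1$,A$_2$. -}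

module Defs where

open import Data.Nat using (ℕ; _≤_)
open import Data.Bool using (Bool; true; false; _∧_; _∨_; not)
open import Data.Product using (_×_; _,_)
open import Data.Sum using (_⊎_)
open import Data.Empty using (⊥)
open import Data.List using (List; []; _∷_; _++_)
open import Data.List.Membership.Propositional using (_∈_)
open import Data.List.Relation.Unary.All using (All)
open import Data.List.Relation.Binary.Permutation.Propositional using (_↭_)
open import Relation.Binary.PropositionalEquality using (_≡_)
open import Relation.Nullary using (¬_)

infixr 30 _∧ᶠ_
infixr 29 _∨ᶠ_
infixr 28 _⊃_
infixr 31 _>_

data Formula : Set where
  atom  : ℕ → Formula
  falsum : Formula
  _∧ᶠ_  : Formula → Formula → Formula
  _∨ᶠ_  : Formula → Formula → Formula
  _⊃_   : Formula → Formula → Formula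
  _>_   : Formula → Formula → Formula

infix 35 ¬ᶠ_
¬ᶠ_ : Formula → Formula
¬ᶠ A = A ⊃ falsum

verum : Formula
verum = ¬ᶠ falsum

_↔ᶠ_ : Formula → Formula → Formula
A ↔ᶠ B = (A ⊃ B) ∧ᶠ (B ⊃ A)

-- Classical propositional tautologies of L: formulas true under every
-- Boolean valuation, where atoms and conditionals A > B are treated as
-- propositional variables (value given by f).

_⇒ᵇ_ : Bool → Bool → Bool
a ⇒ᵇ b = not a ∨ b

eval : (Formula → Bool) → Formula → Bool
eval f (atom p)  = f (atom p)
eval f falsum    = false
eval f (A ∧ᶠ B)  = eval f A ∧ eval f B
eval f (A ∨ᶠ B)  = eval f A ∨ eval f B
eval f (A ⊃ B)   = eval f A ⇒ᵇ eval f B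
eval f (A > B)   = f (A > B)

Tautology : Formula → Set
Tautology A = (f : Formula → Bool) → eval f A ≡ true

-- The fifteen logics: a "level" (PCL, N, T, W, C) and a "suffix"
-- (none, U, A).  PS for a string S corresponds to the calculus CL^S.

data Level : Set where
  lCL lN lT lW lC : Level

rank : Level → ℕ
rank lCL = 0
rank lN  = 1
rank lT  = 2
rank lW  = 3
rank lC  = 4

data Suffix : Set where
  sNone sU sA : Suffix

record Logic : Set where
  constructor logic
  field
    level  : Level
    suffix : Suffix
open Logic public

data ⊢ᴴ_∣_ (L : Logic) : Formula → Set where
  taut : ∀ {A} → Tautology A → ⊢ᴴ L ∣ A
  mp   : ∀ {A B} → ⊢ᴴ L ∣ A → ⊢ᴴ L ∣ (A ⊃ B) → ⊢ᴴ L ∣ B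
  rcea : ∀ {A B C} → ⊢ᴴ L ∣ (A ↔ᶠ B) → ⊢ᴴ L ∣ ((A > C) ↔ᶠ (B > C))
  rck  : ∀ {A B C} → ⊢ᴴ L ∣ (A ⊃ B) → ⊢ᴴ L ∣ ((C > A) ⊃ (C > B))
  ax-ID   : ∀ {A} → ⊢ᴴ L ∣ (A > A)
  ax-RAnd : ∀ {A B C} → ⊢ᴴ L ∣ (((A > B) ∧ᶠ (A > C)) ⊃ (A > (B ∧ᶠ C)))
  ax-CM   : ∀ {A B C} → ⊢ᴴ L ∣ (((A > B) ∧ᶠ (A > C)) ⊃ ((A ∧ᶠ B) > C))
  ax-OR   : ∀ {A B C} → ⊢ᴴ L ∣ (((A > C) ∧ᶠ (B > C)) ⊃ ((A ∨ᶠ B) > C))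
  ax-N    : 1 ≤ rank (level L) → ⊢ᴴ L ∣ (¬ᶠ (verum > falsum))
  ax-T    : ∀ {A} → 2 ≤ rank (level L) → ⊢ᴴ L ∣ (A ⊃ ¬ᶠ (A > falsum))
  ax-W    : ∀ {A B} → 3 ≤ rank (level L) → ⊢ᴴ L ∣ ((A > B) ⊃ (A ⊃ B))
  ax-C    : ∀ {A B} → level L ≡ lC → ⊢ᴴ L ∣ ((A ∧ᶠ B) ⊃ (A > B))
  ax-U₁   : ∀ {A} → suffix L ≡ sU →
            ⊢ᴴ L ∣ (((¬ᶠ A) > falsum) ⊃ ((¬ᶠ ((¬ᶠ A) > falsum)) > falsum))
  ax-U₂   : ∀ {A} → suffix L ≡ sU →
            ⊢ᴴ L ∣ ((¬ᶠ (A > falsum)) ⊃ ((A > falsum) > falsum))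
  ax-A₁   : ∀ {A B C} → suffix L ≡ sA → ⊢ᴴ L ∣ ((A > B) ⊃ (C > (A > B)))
  ax-A₂   : ∀ {A B C} → suffix L ≡ sA →
            ⊢ᴴ L ∣ ((¬ᶠ (A > B)) ⊃ (C > (¬ᶠ (A > B))))

-- Labels.  World labels are natural numbers.  Neighbourhood labels are
-- either variables a,b,c,… (nv k) or singletons {x} (sng x).

data NLabel : Set where
  nv  : ℕ → NLabel
  sng : ℕ → NLabel

infix 10 _∈N_ _∈ₗ_ _⊆ₗ_ _∶_ _⊩∃_ _⊩∀_
data LFormula : Set where
  _∈N_     : NLabel → ℕ → LFormula
  _∈ₗ_     : ℕ → NLabel → LFormula
  _⊆ₗ_     : NLabel → NLabel → LFormula
  _∶_      : ℕ → Formula → LFormula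
  _⊩∃_     : NLabel → Formula → LFormula
  _⊩∀_     : NLabel → Formula → LFormula
  _⊩[_]_∣_ : ℕ → NLabel → Formula → Formula → LFormula

occWN : ℕ → NLabel → Set
occWN y (nv _)  = ⊥
occWN y (sng x) = y ≡ x

occW : ℕ → LFormula → Set
occW y (a ∈N x)          = occWN y a ⊎ y ≡ x
occW y (x ∈ₗ a)          = y ≡ x ⊎ occWN y a
occW y (a ⊆ₗ b)          = occWN y a ⊎ occWN y b
occW y (x ∶ A)           = y ≡ x
occW y (a ⊩∃ A)          = occWN y a
occW y (a ⊩∀ A)          = occWN y a
occW y (x ⊩[ a ] A ∣ B)  = y ≡ x ⊎ occWN y a

occNN : ℕ → NLabel → Set
occNN k (nv m)  = k ≡ m
occNN k (sng _) = ⊥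

occN : ℕ → LFormula → Set
occN k (a ∈N x)          = occNN k a
occN k (x ∈ₗ a)          = occNN k a
occN k (a ⊆ₗ b)          = occNN k a ⊎ occNN k b
occN k (x ∶ A)           = ⊥
occN k (a ⊩∃ A)          = occNN k a
occN k (a ⊩∀ A)          = occNN k a
occN k (x ⊩[ a ] A ∣ B)  = occNN k a

FreshW : ℕ → List LFormula → List LFormula → Set
FreshW y Γ Δ = All (λ φ → ¬ occW y φ) (Γ ++ Δ)

FreshN : ℕ → List LFormula → List LFormula → Set
FreshN k Γ Δ = All (λ φ → ¬ occN k φ) (Γ ++ Δ)

data AtKind : Set where
  atP  : ℕ → AtKind
  atIn : NLabel → AtKind
  atNb : NLabel → AtKind
  atSg : ℕ → AtKind

At : AtKind → ℕ → LFormula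
At (atP P)  x = x ∶ atom P
At (atIn a) x = x ∈ₗ a
At (atNb a) x = a ∈N x
At (atSg z) x = x ∈ₗ sng z

-- Sequents Γ ⇒ Δ are multisets, represented by lists up to permutation
-- (rule exch).  Rules whose principal formulas are repeated in the
-- premisses are stated with membership side conditions (this covers the
-- contracted instances "with coinciding principal atoms written once").

infix 4 _⊢_⇒_

data _⊢_⇒_ (L : Logic) : List LFormula → List LFormula → Set where
  exch : ∀ {Γ Γ' Δ Δ'} → Γ ↭ Γ' → Δ ↭ Δ' → L ⊢ Γ ⇒ Δ → L ⊢ Γ' ⇒ Δ'
  init : ∀ {Γ Δ x p} → (x ∶ atom p) ∈ Γ → (x ∶ atom p) ∈ Δ → L ⊢ Γ ⇒ Δ
  init⊥ : ∀ {Γ Δ x} → (x ∶ falsum) ∈ Γ → L ⊢ Γ ⇒ Δ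
  L∧ : ∀ {Γ Δ x A B} → L ⊢ x ∶ A ∷ x ∶ B ∷ Γ ⇒ Δ → L ⊢ x ∶ (A ∧ᶠ B) ∷ Γ ⇒ Δ
  R∧ : ∀ {Γ Δ x A B} → L ⊢ Γ ⇒ x ∶ A ∷ Δ → L ⊢ Γ ⇒ x ∶ B ∷ Δ →
       L ⊢ Γ ⇒ x ∶ (A ∧ᶠ B) ∷ Δ
  L∨ : ∀ {Γ Δ x A B} → L ⊢ x ∶ A ∷ Γ ⇒ Δ → L ⊢ x ∶ B ∷ Γ ⇒ Δ →
       L ⊢ x ∶ (A ∨ᶠ B) ∷ Γ ⇒ Δ
  R∨ : ∀ {Γ Δ x A B} → L ⊢ Γ ⇒ x ∶ A ∷ x ∶ B ∷ Δ → L ⊢ Γ ⇒ x ∶ (A ∨ᶠ B) ∷ Δ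
  L⊃ : ∀ {Γ Δ x A B} → L ⊢ Γ ⇒ x ∶ A ∷ Δ → L ⊢ x ∶ B ∷ Γ ⇒ Δ →
       L ⊢ x ∶ (A ⊃ B) ∷ Γ ⇒ Δ
  R⊃ : ∀ {Γ Δ x A B} → L ⊢ x ∶ A ∷ Γ ⇒ x ∶ B ∷ Δ → L ⊢ Γ ⇒ x ∶ (A ⊃ B) ∷ Δ
  L∀ : ∀ {Γ Δ x a A} → (x ∈ₗ a) ∈ Γ → (a ⊩∀ A) ∈ Γ →
       L ⊢ x ∶ A ∷ Γ ⇒ Δ → L ⊢ Γ ⇒ Δ
  R∀ : ∀ {Γ Δ x a A} → FreshW x Γ (a ⊩∀ A ∷ Δ) →
       L ⊢ x ∈ₗ a ∷ Γ ⇒ x ∶ A ∷ Δ → L ⊢ Γ ⇒ a ⊩∀ A ∷ Δ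
  L∃ : ∀ {Γ Δ x a A} → FreshW x (a ⊩∃ A ∷ Γ) Δ →
       L ⊢ x ∈ₗ a ∷ x ∶ A ∷ Γ ⇒ Δ → L ⊢ a ⊩∃ A ∷ Γ ⇒ Δ
  R∃ : ∀ {Γ Δ x a A} → (x ∈ₗ a) ∈ Γ → (a ⊩∃ A) ∈ Δ →
       L ⊢ Γ ⇒ x ∶ A ∷ Δ → L ⊢ Γ ⇒ Δ
  R> : ∀ {Γ Δ x k A B} → FreshN k Γ (x ∶ (A > B) ∷ Δ) →
       L ⊢ nv k ∈N x ∷ nv k ⊩∃ A ∷ Γ ⇒ x ⊩[ nv k ] A ∣ B ∷ Δ →
       L ⊢ Γ ⇒ x ∶ (A > B) ∷ Δ
  L> : ∀ {Γ Δ x a A B} → (a ∈N x) ∈ Γ → (x ∶ (A > B)) ∈ Γ →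
       L ⊢ Γ ⇒ a ⊩∃ A ∷ Δ → L ⊢ x ⊩[ a ] A ∣ B ∷ Γ ⇒ Δ → L ⊢ Γ ⇒ Δ
  R∣ : ∀ {Γ Δ x a c A B} → (c ∈N x) ∈ Γ → (c ⊆ₗ a) ∈ Γ →
       (x ⊩[ a ] A ∣ B) ∈ Δ →
       L ⊢ Γ ⇒ c ⊩∃ A ∷ Δ → L ⊢ Γ ⇒ c ⊩∀ (A ⊃ B) ∷ Δ → L ⊢ Γ ⇒ Δ
  L∣ : ∀ {Γ Δ x a k A B} → FreshN k (x ⊩[ a ] A ∣ B ∷ Γ) Δ →
       L ⊢ nv k ∈N x ∷ nv k ⊆ₗ a ∷ nv k ⊩∃ A ∷ nv k ⊩∀ (A ⊃ B) ∷ Γ ⇒ Δ →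
       L ⊢ x ⊩[ a ] A ∣ B ∷ Γ ⇒ Δ
  Ref : ∀ {Γ Δ a} → L ⊢ a ⊆ₗ a ∷ Γ ⇒ Δ → L ⊢ Γ ⇒ Δ
  Tr : ∀ {Γ Δ a b c} → (c ⊆ₗ b) ∈ Γ → (b ⊆ₗ a) ∈ Γ →
       L ⊢ c ⊆ₗ a ∷ Γ ⇒ Δ → L ⊢ Γ ⇒ Δ
  L⊆ : ∀ {Γ Δ x a b} → (x ∈ₗ a) ∈ Γ → (a ⊆ₗ b) ∈ Γ →
       L ⊢ x ∈ₗ b ∷ Γ ⇒ Δ → L ⊢ Γ ⇒ Δ
  ruleN : ∀ {Γ Δ x k} → 1 ≤ rank (level L) → FreshN k Γ Δ →
          L ⊢ nv k ∈N x ∷ Γ ⇒ Δ → L ⊢ Γ ⇒ Δ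
  rule0 : ∀ {Γ Δ x y a} → 1 ≤ rank (level L) → (a ∈N x) ∈ Γ → FreshW y Γ Δ →
          L ⊢ y ∈ₗ a ∷ Γ ⇒ Δ → L ⊢ Γ ⇒ Δ
  ruleT : ∀ {Γ Δ x k} → 2 ≤ rank (level L) → FreshN k Γ Δ →
          L ⊢ x ∈ₗ nv k ∷ nv k ∈N x ∷ Γ ⇒ Δ → L ⊢ Γ ⇒ Δ
  ruleW : ∀ {Γ Δ x a} → 3 ≤ rank (level L) → (a ∈N x) ∈ Γ →
          L ⊢ x ∈ₗ a ∷ Γ ⇒ Δ → L ⊢ Γ ⇒ Δ
  ruleSingle : ∀ {Γ Δ x} → level L ≡ lC → (sng x ∈N x) ∈ Γ →
          L ⊢ x ∈ₗ sng x ∷ Γ ⇒ Δ → L ⊢ Γ ⇒ Δ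
  ruleC : ∀ {Γ Δ x a} → level L ≡ lC → (a ∈N x) ∈ Γ →
          L ⊢ sng x ∈N x ∷ sng x ⊆ₗ a ∷ Γ ⇒ Δ → L ⊢ Γ ⇒ Δ
  Repl₁ : ∀ {Γ Δ x y} (t : AtKind) → level L ≡ lC → (y ∈ₗ sng x) ∈ Γ →
          At t x ∈ Γ → L ⊢ At t y ∷ Γ ⇒ Δ → L ⊢ Γ ⇒ Δ
  Repl₂ : ∀ {Γ Δ x y} (t : AtKind) → level L ≡ lC → (y ∈ₗ sng x) ∈ Γ →
          At t y ∈ Γ → L ⊢ At t x ∷ Γ ⇒ Δ → L ⊢ Γ ⇒ Δ
  ruleU₁ : ∀ {Γ Δ x y z a b k} → suffix L ≡ sU →
          (a ∈N x) ∈ Γ → (y ∈ₗ a) ∈ Γ → (b ∈N y) ∈ Γ → (z ∈ₗ b) ∈ Γ →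
          FreshN k Γ Δ →
          L ⊢ z ∈ₗ nv k ∷ nv k ∈N x ∷ Γ ⇒ Δ → L ⊢ Γ ⇒ Δ
  ruleU₂ : ∀ {Γ Δ x y z a b k} → suffix L ≡ sU →
          (a ∈N x) ∈ Γ → (y ∈ₗ a) ∈ Γ → (b ∈N x) ∈ Γ → (z ∈ₗ b) ∈ Γ →
          FreshN k Γ Δ →
          L ⊢ z ∈ₗ nv k ∷ nv k ∈N y ∷ Γ ⇒ Δ → L ⊢ Γ ⇒ Δ
  ruleA₁ : ∀ {Γ Δ x y a b} → suffix L ≡ sA →
          (a ∈N x) ∈ Γ → (y ∈ₗ a) ∈ Γ → (b ∈N x) ∈ Γ →
          L ⊢ b ∈N y ∷ Γ ⇒ Δ → L ⊢ Γ ⇒ Δ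
  ruleA₂ : ∀ {Γ Δ x y a b} → suffix L ≡ sA →
          (a ∈N x) ∈ Γ → (y ∈ₗ a) ∈ Γ → (b ∈N y) ∈ Γ →
          L ⊢ b ∈N x ∷ Γ ⇒ Δ → L ⊢ Γ ⇒ Δ

module Submission where

-- The axioms and the rules RCEA, RCK have direct labelled derivations, and tautologies are found
-- by a root-first proof search that follows Boolean validity (atoms and conditionals being
-- propositional variables).  Modus ponens, however, needs cut, which is not a rule of the calculus,
-- so the bulk of the proof shows that cut is admissible, along the usual lines: with derivations
-- indexed by height, weakening, renaming of labels and contraction are height-preserving, every rule
-- with a principal formula is height-preserving invertible, and a cut is pushed upwards by induction
-- on the weight of the cut formula with a nested induction on the heights of the two derivations.
-- All rules are instances of one generic rule format, so these structural facts are proved once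
-- for the whole calculus.

open import Defs
open import Data.Nat using (ℕ; zero; suc; _≤_; _<_; _⊔_; _+_; z≤n; s≤s)
open import Data.Nat.Properties using (_≟_; ≤-refl; ≤-trans; m≤m⊔n; m≤n⊔m; ≤⇒≯; ≤-reflexive; n≤1+n; ≤-pred; +-assoc; +-comm; +-monoˡ-≤; m≤m+n; m≤n+m; +-identityʳ)
open import Data.Bool using (Bool; true; false; _∧_; _∨_; not)
open import Data.Product using (Σ; _×_; _,_; proj₁; proj₂)
open import Data.Sum using (_⊎_; inj₁; inj₂)
open import Data.Empty using (⊥; ⊥-elim)
open import Data.Unit using (⊤; tt)
open import Data.List using (List; []; _∷_; _++_; map)
open import Data.List.Properties using (map-++; ++-assoc; ++-identityʳ)
open import Data.List.Membership.Propositional using (_∈_; find)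
open import Data.List.Membership.Propositional.Properties using (∈-map⁺; ∈-++⁺ˡ; ∈-++⁺ʳ; ∈-++⁻; ∈-∃++)
open import Data.List.Relation.Unary.Any using (Any; here; there; any?)
import Data.List.Relation.Unary.Any as Any
open import Data.List.Relation.Unary.All using (All; []; _∷_)
import Data.List.Relation.Unary.All as All
open import Data.List.Relation.Unary.All.Properties using (++⁻ˡ; ++⁻ʳ; anti-mono)
open import Data.List.Relation.Binary.Permutation.Propositional using (_↭_; ↭-refl; ↭-sym; ↭-trans; ↭-reflexive; prep; swap)
open import Data.List.Relation.Binary.Permutation.Propositional.Properties using (map⁺; ∈-resp-↭; ++⁺ˡ; ++⁺ʳ; ++⁺; shift; shifts; drop-∷; ++-comm; Any-resp-↭; All-resp-↭)
open import Relation.Binary.PropositionalEquality using (_≡_; refl; sym; trans; cong; cong₂; subst; subst₂)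
open import Relation.Nullary using (¬_; Dec; yes; no)
open import Relation.Nullary.Decidable using (map′)
import Data.Sum.Properties as Sum
import Data.Product.Properties as Prod
open import Function using (_$_; id; case_of_)
open import Data.List.Relation.Binary.Subset.Propositional using (_⊆_)

_≟F_ : (A B : Formula) → Dec (A ≡ B)
atom p ≟F atom q with p ≟ q
... | yes refl = yes refl
... | no ne = no λ { refl → ne refl }
atom _ ≟F falsum = no λ ()
atom _ ≟F (_ ∧ᶠ _) = no λ ()
atom _ ≟F (_ ∨ᶠ _) = no λ ()
atom _ ≟F (_ ⊃ _) = no λ ()
atom _ ≟F (_ > _) = no λ ()
falsum ≟F atom _ = no λ ()
falsum ≟F falsum = yes refl
falsum ≟F (_ ∧ᶠ _) = no λ ()
falsum ≟F (_ ∨ᶠ _) = no λ ()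
falsum ≟F (_ ⊃ _) = no λ ()
falsum ≟F (_ > _) = no λ ()
(A ∧ᶠ B) ≟F (C ∧ᶠ Deriv) with A ≟F C | B ≟F Deriv
... | yes refl | yes refl = yes refl
... | no ne | _ = no λ { refl → ne refl }
... | _ | no ne = no λ { refl → ne refl }
(_ ∧ᶠ _) ≟F atom _ = no λ ()
(_ ∧ᶠ _) ≟F falsum = no λ ()
(_ ∧ᶠ _) ≟F (_ ∨ᶠ _) = no λ ()
(_ ∧ᶠ _) ≟F (_ ⊃ _) = no λ ()
(_ ∧ᶠ _) ≟F (_ > _) = no λ ()
(A ∨ᶠ B) ≟F (C ∨ᶠ Deriv) with A ≟F C | B ≟F Deriv
... | yes refl | yes refl = yes refl
... | no ne | _ = no λ { refl → ne refl }
... | _ | no ne = no λ { refl → ne refl }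
(_ ∨ᶠ _) ≟F atom _ = no λ ()
(_ ∨ᶠ _) ≟F falsum = no λ ()
(_ ∨ᶠ _) ≟F (_ ∧ᶠ _) = no λ ()
(_ ∨ᶠ _) ≟F (_ ⊃ _) = no λ ()
(_ ∨ᶠ _) ≟F (_ > _) = no λ ()
(A ⊃ B) ≟F (C ⊃ Deriv) with A ≟F C | B ≟F Deriv
... | yes refl | yes refl = yes refl
... | no ne | _ = no λ { refl → ne refl }
... | _ | no ne = no λ { refl → ne refl }
(_ ⊃ _) ≟F atom _ = no λ ()
(_ ⊃ _) ≟F falsum = no λ ()
(_ ⊃ _) ≟F (_ ∧ᶠ _) = no λ ()
(_ ⊃ _) ≟F (_ ∨ᶠ _) = no λ ()
(_ ⊃ _) ≟F (_ > _) = no λ ()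
(A > B) ≟F (C > Deriv) with A ≟F C | B ≟F Deriv
... | yes refl | yes refl = yes refl
... | no ne | _ = no λ { refl → ne refl }
... | _ | no ne = no λ { refl → ne refl }
(_ > _) ≟F atom _ = no λ ()
(_ > _) ≟F falsum = no λ ()
(_ > _) ≟F (_ ∧ᶠ _) = no λ ()
(_ > _) ≟F (_ ∨ᶠ _) = no λ ()
(_ > _) ≟F (_ ⊃ _) = no λ ()

open import Data.List.Membership.DecPropositional _≟F_ using (_∈?_)

_≟NL_ : (a b : NLabel) → Dec (a ≡ b)
nv k ≟NL nv j with k ≟ j
... | yes refl = yes refl
... | no ne = no λ { refl → ne refl }
nv _ ≟NL sng _ = no λ ()
sng _ ≟NL nv _ = no λ ()
sng k ≟NL sng j with k ≟ j
... | yes refl = yes refl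
... | no ne = no λ { refl → ne refl }

LFormulaCode : Set
LFormulaCode = (NLabel × ℕ) ⊎ (ℕ × NLabel) ⊎ (NLabel × NLabel) ⊎ (ℕ × Formula)
             ⊎ (NLabel × Formula) ⊎ (NLabel × Formula) ⊎ (ℕ × NLabel × Formula × Formula)

encode : LFormula → LFormulaCode
encode (a ∈N x) = inj₁ (a , x)
encode (x ∈ₗ a) = inj₂ (inj₁ (x , a))
encode (a ⊆ₗ b) = inj₂ (inj₂ (inj₁ (a , b)))
encode (x ∶ A) = inj₂ (inj₂ (inj₂ (inj₁ (x , A))))
encode (a ⊩∃ A) = inj₂ (inj₂ (inj₂ (inj₂ (inj₁ (a , A)))))
encode (a ⊩∀ A) = inj₂ (inj₂ (inj₂ (inj₂ (inj₂ (inj₁ (a , A))))))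
encode (x ⊩[ a ] A ∣ B) = inj₂ (inj₂ (inj₂ (inj₂ (inj₂ (inj₂ (x , a , A , B))))))

decode : LFormulaCode → LFormula
decode (inj₁ (a , x)) = a ∈N x
decode (inj₂ (inj₁ (x , a))) = x ∈ₗ a
decode (inj₂ (inj₂ (inj₁ (a , b)))) = a ⊆ₗ b
decode (inj₂ (inj₂ (inj₂ (inj₁ (x , A))))) = x ∶ A
decode (inj₂ (inj₂ (inj₂ (inj₂ (inj₁ (a , A)))))) = a ⊩∃ A
decode (inj₂ (inj₂ (inj₂ (inj₂ (inj₂ (inj₁ (a , A))))))) = a ⊩∀ A
decode (inj₂ (inj₂ (inj₂ (inj₂ (inj₂ (inj₂ (x , a , A , B))))))) = x ⊩[ a ] A ∣ B

decode-encode : ∀ φ → decode (encode φ) ≡ φ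
decode-encode (a ∈N x) = refl
decode-encode (x ∈ₗ a) = refl
decode-encode (a ⊆ₗ b) = refl
decode-encode (x ∶ A) = refl
decode-encode (a ⊩∃ A) = refl
decode-encode (a ⊩∀ A) = refl
decode-encode (x ⊩[ a ] A ∣ B) = refl

_≟Code_ : (c d : LFormulaCode) → Dec (c ≡ d)
_≟Code_ = Sum.≡-dec (Prod.≡-dec _≟NL_ _≟_) (Sum.≡-dec (Prod.≡-dec _≟_ _≟NL_) (Sum.≡-dec (Prod.≡-dec _≟NL_ _≟NL_)
          (Sum.≡-dec (Prod.≡-dec _≟_ _≟F_) (Sum.≡-dec (Prod.≡-dec _≟NL_ _≟F_) (Sum.≡-dec (Prod.≡-dec _≟NL_ _≟F_)
          (Prod.≡-dec _≟_ (Prod.≡-dec _≟NL_ (Prod.≡-dec _≟F_ _≟F_))))))))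

_≟L_ : (φ ψ : LFormula) → Dec (φ ≡ ψ)
φ ≟L ψ = map′ (λ eq → trans (sym (decode-encode φ)) (trans (cong decode eq) (decode-encode ψ))) (cong encode)
              (encode φ ≟Code encode ψ)

record Renaming : Set where
  constructor mkRenaming
  field
    onWorld : ℕ → ℕ
    onNbhd : ℕ → NLabel
open Renaming public

renameN : Renaming → NLabel → NLabel
renameN ρ (nv k) = onNbhd ρ k
renameN ρ (sng x) = sng (onWorld ρ x)

rename : Renaming → LFormula → LFormula
rename ρ (a ∈N x) = renameN ρ a ∈N onWorld ρ x
rename ρ (x ∈ₗ a) = onWorld ρ x ∈ₗ renameN ρ a
rename ρ (a ⊆ₗ b) = renameN ρ a ⊆ₗ renameN ρ b
rename ρ (x ∶ A) = onWorld ρ x ∶ A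
rename ρ (a ⊩∃ A) = renameN ρ a ⊩∃ A
rename ρ (a ⊩∀ A) = renameN ρ a ⊩∀ A
rename ρ (x ⊩[ a ] A ∣ B) = onWorld ρ x ⊩[ renameN ρ a ] A ∣ B

renameAll : Renaming → List LFormula → List LFormula
renameAll ρ = map (rename ρ)

Premiss : Set
Premiss = List LFormula × List LFormula

renamePremiss : Renaming → Premiss → Premiss
renamePremiss ρ (aL , aR) = renameAll ρ aL , renameAll ρ aR

idRen : Renaming
idRen = mkRenaming (λ x → x) nv

allWorldsTo : ℕ → Renaming
allWorldsTo x = mkRenaming (λ _ → x) nv

renameN-id : ∀ a → renameN idRen a ≡ a
renameN-id (nv k) = refl
renameN-id (sng x) = refl

rename-id : ∀ φ → rename idRen φ ≡ φ
rename-id (a ∈N x) = cong (_∈N x) (renameN-id a)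
rename-id (x ∈ₗ a) = cong (x ∈ₗ_) (renameN-id a)
rename-id (a ⊆ₗ b) = cong₂ _⊆ₗ_ (renameN-id a) (renameN-id b)
rename-id (x ∶ A) = refl
rename-id (a ⊩∃ A) = cong (_⊩∃ A) (renameN-id a)
rename-id (a ⊩∀ A) = cong (_⊩∀ A) (renameN-id a)
rename-id (x ⊩[ a ] A ∣ B) = cong (λ b → x ⊩[ b ] A ∣ B) (renameN-id a)

renameAll-id : ∀ Γ → renameAll idRen Γ ≡ Γ
renameAll-id [] = refl
renameAll-id (φ ∷ Γ) = cong₂ _∷_ (rename-id φ) (renameAll-id Γ)

setWorld : Renaming → ℕ → ℕ → Renaming
setWorld ρ y z = mkRenaming (λ v → f v (v ≟ y)) (onNbhd ρ)
  where f : (v : ℕ) → Dec (v ≡ y) → ℕ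
        f v (yes _) = z
        f v (no _) = onWorld ρ v

setNbhd : Renaming → ℕ → NLabel → Renaming
setNbhd ρ k b = mkRenaming (onWorld ρ) (λ j → f j (j ≟ k))
  where f : (j : ℕ) → Dec (j ≡ k) → NLabel
        f j (yes _) = b
        f j (no _) = onNbhd ρ j

setWorld-≡ : ∀ ρ y z → onWorld (setWorld ρ y z) y ≡ z
setWorld-≡ ρ y z with y ≟ y
... | yes _ = refl
... | no ne = ⊥-elim (ne refl)

setWorld-≢ : ∀ ρ y z v → ¬ v ≡ y → onWorld (setWorld ρ y z) v ≡ onWorld ρ v
setWorld-≢ ρ y z v ne with v ≟ y
... | yes e = ⊥-elim (ne e)
... | no _ = refl

setNbhd-≡ : ∀ ρ k b → onNbhd (setNbhd ρ k b) k ≡ b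
setNbhd-≡ ρ k b with k ≟ k
... | yes _ = refl
... | no ne = ⊥-elim (ne refl)

setNbhd-≢ : ∀ ρ k b j → ¬ j ≡ k → onNbhd (setNbhd ρ k b) j ≡ onNbhd ρ j
setNbhd-≢ ρ k b j ne with j ≟ k
... | yes e = ⊥-elim (ne e)
... | no _ = refl

setWorld-freshN : ∀ ρ y z a → ¬ occWN y a → renameN (setWorld ρ y z) a ≡ renameN ρ a
setWorld-freshN ρ y z (nv k) _ = refl
setWorld-freshN ρ y z (sng x) nv0 = cong sng (setWorld-≢ ρ y z x λ e → nv0 (sym e))

setWorld-fresh : ∀ ρ y z φ → ¬ occW y φ → rename (setWorld ρ y z) φ ≡ rename ρ φ
setWorld-fresh ρ y z (a ∈N x) nv0 = cong₂ _∈N_ (setWorld-freshN ρ y z a (λ o → nv0 (inj₁ o)))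
    (setWorld-≢ ρ y z x (λ e → nv0 (inj₂ (sym e))))
setWorld-fresh ρ y z (x ∈ₗ a) nv0 = cong₂ _∈ₗ_ (setWorld-≢ ρ y z x (λ e → nv0 (inj₁ (sym e))))
    (setWorld-freshN ρ y z a (λ o → nv0 (inj₂ o)))
setWorld-fresh ρ y z (a ⊆ₗ b) nv0 = cong₂ _⊆ₗ_ (setWorld-freshN ρ y z a (λ o → nv0 (inj₁ o))) (setWorld-freshN ρ y z b (λ o → nv0 (inj₂ o)))
setWorld-fresh ρ y z (x ∶ A) nv0 = cong (_∶ A) (setWorld-≢ ρ y z x (λ e → nv0 (sym e)))
setWorld-fresh ρ y z (a ⊩∃ A) nv0 = cong (_⊩∃ A) (setWorld-freshN ρ y z a nv0)
setWorld-fresh ρ y z (a ⊩∀ A) nv0 = cong (_⊩∀ A) (setWorld-freshN ρ y z a nv0)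
setWorld-fresh ρ y z (x ⊩[ a ] A ∣ B) nv0 = cong₂ (λ u b → u ⊩[ b ] A ∣ B) (setWorld-≢ ρ y z x (λ e → nv0
    (inj₁ (sym e)))) (setWorld-freshN ρ y z a (λ o → nv0 (inj₂ o)))

setNbhd-freshN : ∀ ρ k b a → ¬ occNN k a → renameN (setNbhd ρ k b) a ≡ renameN ρ a
setNbhd-freshN ρ k b (nv j) nv0 = setNbhd-≢ ρ k b j (λ e → nv0 (sym e))
setNbhd-freshN ρ k b (sng x) _ = refl

setNbhd-fresh : ∀ ρ k b φ → ¬ occN k φ → rename (setNbhd ρ k b) φ ≡ rename ρ φ
setNbhd-fresh ρ k b (a ∈N x) nv0 = cong (_∈N onWorld ρ x) (setNbhd-freshN ρ k b a nv0)
setNbhd-fresh ρ k b (x ∈ₗ a) nv0 = cong (onWorld ρ x ∈ₗ_) (setNbhd-freshN ρ k b a nv0)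
setNbhd-fresh ρ k b (a ⊆ₗ c) nv0 = cong₂ _⊆ₗ_ (setNbhd-freshN ρ k b a (λ o → nv0 (inj₁ o))) (setNbhd-freshN ρ k b c (λ o → nv0 (inj₂ o)))
setNbhd-fresh ρ k b (x ∶ A) nv0 = refl
setNbhd-fresh ρ k b (a ⊩∃ A) nv0 = cong (_⊩∃ A) (setNbhd-freshN ρ k b a nv0)
setNbhd-fresh ρ k b (a ⊩∀ A) nv0 = cong (_⊩∀ A) (setNbhd-freshN ρ k b a nv0)
setNbhd-fresh ρ k b (x ⊩[ a ] A ∣ B) nv0 = cong (λ c → onWorld ρ x ⊩[ c ] A ∣ B) (setNbhd-freshN ρ k b a nv0)

data Eigen : Set where
  noEigen : Eigen
  worldEigen : ℕ → Eigen
  nbhdEigen : ℕ → Eigen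

occEigen : Eigen → LFormula → Set
occEigen noEigen φ = ⊥
occEigen (worldEigen y) φ = occW y φ
occEigen (nbhdEigen k) φ = occN k φ

FreshEigen : Eigen → List LFormula → List LFormula → Set
FreshEigen e Γ Δ = All (λ φ → ¬ occEigen e φ) (Γ ++ Δ)

-- A renaming may send a neighbourhood variable to a singleton {x}, but an eigenvariable must stay a variable.
KeepsNbhdVar : Renaming → Eigen → Set
KeepsNbhdVar ρ noEigen = ⊤
KeepsNbhdVar ρ (worldEigen y) = ⊤
KeepsNbhdVar ρ (nbhdEigen k) = Σ ℕ λ z → onNbhd ρ k ≡ nv z

renameEigen : (ρ : Renaming) (e : Eigen) → KeepsNbhdVar ρ e → Eigen
renameEigen ρ noEigen _ = noEigen
renameEigen ρ (worldEigen y) _ = worldEigen (onWorld ρ y)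
renameEigen ρ (nbhdEigen k) (z , _) = nbhdEigen z

maxWorldN : NLabel → ℕ
maxWorldN (nv _) = 0
maxWorldN (sng x) = x

maxWorld : LFormula → ℕ
maxWorld (a ∈N x) = maxWorldN a ⊔ x
maxWorld (x ∈ₗ a) = x ⊔ maxWorldN a
maxWorld (a ⊆ₗ b) = maxWorldN a ⊔ maxWorldN b
maxWorld (x ∶ A) = x
maxWorld (a ⊩∃ A) = maxWorldN a
maxWorld (a ⊩∀ A) = maxWorldN a
maxWorld (x ⊩[ a ] A ∣ B) = x ⊔ maxWorldN a

maxNbhdN : NLabel → ℕ
maxNbhdN (nv k) = k
maxNbhdN (sng _) = 0

maxNbhd : LFormula → ℕ
maxNbhd (a ∈N x) = maxNbhdN a
maxNbhd (x ∈ₗ a) = maxNbhdN a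
maxNbhd (a ⊆ₗ b) = maxNbhdN a ⊔ maxNbhdN b
maxNbhd (x ∶ A) = 0
maxNbhd (a ⊩∃ A) = maxNbhdN a
maxNbhd (a ⊩∀ A) = maxNbhdN a
maxNbhd (x ⊩[ a ] A ∣ B) = maxNbhdN a

maxWorlds : List LFormula → ℕ
maxWorlds [] = 0
maxWorlds (φ ∷ Γ) = maxWorld φ ⊔ maxWorlds Γ

maxNbhds : List LFormula → ℕ
maxNbhds [] = 0
maxNbhds (φ ∷ Γ) = maxNbhd φ ⊔ maxNbhds Γ

occWN⇒≤max : ∀ y a → occWN y a → y ≤ maxWorldN a
occWN⇒≤max y (nv _) ()
occWN⇒≤max y (sng x) refl = ≤-refl

occW⇒≤max : ∀ y φ → occW y φ → y ≤ maxWorld φ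
occW⇒≤max y (a ∈N x) (inj₁ o) = ≤-trans (occWN⇒≤max y a o) (m≤m⊔n _ _)
occW⇒≤max y (a ∈N x) (inj₂ refl) = m≤n⊔m _ _
occW⇒≤max y (x ∈ₗ a) (inj₁ refl) = m≤m⊔n _ _
occW⇒≤max y (x ∈ₗ a) (inj₂ o) = ≤-trans (occWN⇒≤max y a o) (m≤n⊔m _ _)
occW⇒≤max y (a ⊆ₗ b) (inj₁ o) = ≤-trans (occWN⇒≤max y a o) (m≤m⊔n _ _)
occW⇒≤max y (a ⊆ₗ b) (inj₂ o) = ≤-trans (occWN⇒≤max y b o) (m≤n⊔m _ _)
occW⇒≤max y (x ∶ A) refl = ≤-refl
occW⇒≤max y (a ⊩∃ A) o = occWN⇒≤max y a o
occW⇒≤max y (a ⊩∀ A) o = occWN⇒≤max y a o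
occW⇒≤max y (x ⊩[ a ] A ∣ B) (inj₁ refl) = m≤m⊔n _ _
occW⇒≤max y (x ⊩[ a ] A ∣ B) (inj₂ o) = ≤-trans (occWN⇒≤max y a o) (m≤n⊔m _ _)

occNN⇒≤max : ∀ k a → occNN k a → k ≤ maxNbhdN a
occNN⇒≤max k (nv j) refl = ≤-refl
occNN⇒≤max k (sng _) ()

occN⇒≤max : ∀ k φ → occN k φ → k ≤ maxNbhd φ
occN⇒≤max k (a ∈N x) o = occNN⇒≤max k a o
occN⇒≤max k (x ∈ₗ a) o = occNN⇒≤max k a o
occN⇒≤max k (a ⊆ₗ b) (inj₁ o) = ≤-trans (occNN⇒≤max k a o) (m≤m⊔n _ _)
occN⇒≤max k (a ⊆ₗ b) (inj₂ o) = ≤-trans (occNN⇒≤max k b o) (m≤n⊔m _ _)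
occN⇒≤max k (x ∶ A) ()
occN⇒≤max k (a ⊩∃ A) o = occNN⇒≤max k a o
occN⇒≤max k (a ⊩∀ A) o = occNN⇒≤max k a o
occN⇒≤max k (x ⊩[ a ] A ∣ B) o = occNN⇒≤max k a o

>max⇒freshW : ∀ Γ y → maxWorlds Γ < y → All (λ φ → ¬ occW y φ) Γ
>max⇒freshW [] y _ = []
>max⇒freshW (φ ∷ Γ) y lt = (λ o → ≤⇒≯ (≤-trans (occW⇒≤max y φ o) (m≤m⊔n _ _)) lt) ∷ >max⇒freshW Γ y (≤-trans
    (s≤s (m≤n⊔m (maxWorld φ) _)) lt)

>max⇒freshN : ∀ Γ k → maxNbhds Γ < k → All (λ φ → ¬ occN k φ) Γ
>max⇒freshN [] k _ = []
>max⇒freshN (φ ∷ Γ) k lt = (λ o → ≤⇒≯ (≤-trans (occN⇒≤max k φ o) (m≤m⊔n _ _)) lt) ∷ >max⇒freshN Γ k (≤-trans (s≤s (m≤n⊔m (maxNbhd φ) _)) lt)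

noEigenFresh : ∀ (X : List LFormula) → All (λ φ → ¬ ⊥) X
noEigenFresh [] = []
noEigenFresh (_ ∷ X) = (λ ()) ∷ noEigenFresh X

freshenEigen : (e : Eigen) (ρ : Renaming) (Γ Δ : List LFormula) →
         Σ Renaming λ ρ' → Σ (KeepsNbhdVar ρ' e) λ ok → FreshEigen (renameEigen ρ' e ok) Γ Δ ×
           (∀ φ → ¬ occEigen e φ → rename ρ' φ ≡ rename ρ φ)
freshenEigen noEigen ρ Γ Δ = ρ , tt , noEigenFresh (Γ ++ Δ) , λ _ _ → refl
freshenEigen (worldEigen y) ρ Γ Δ =
  setWorld ρ y z , tt ,
  subst (λ u → All (λ φ → ¬ occW u φ) (Γ ++ Δ)) (sym (setWorld-≡ ρ y z)) (>max⇒freshW (Γ ++ Δ) z ≤-refl) ,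
  setWorld-fresh ρ y z
  where z = suc (maxWorlds (Γ ++ Δ))
freshenEigen (nbhdEigen k) ρ Γ Δ =
  setNbhd ρ k (nv z) , (z , setNbhd-≡ ρ k (nv z)) , >max⇒freshN (Γ ++ Δ) z ≤-refl , setNbhd-fresh ρ k (nv z)
  where z = suc (maxNbhds (Γ ++ Δ))

renameAtKind : Renaming → AtKind → AtKind
renameAtKind ρ (atP P) = atP P
renameAtKind ρ (atIn a) = atIn (renameN ρ a)
renameAtKind ρ (atNb a) = atNb (renameN ρ a)
renameAtKind ρ (atSg z) = atSg (onWorld ρ z)

rename-At : ∀ ρ t x → rename ρ (At t x) ≡ At (renameAtKind ρ t) (onWorld ρ x)
rename-At ρ (atP P) x = refl
rename-At ρ (atIn a) x = refl
rename-At ρ (atNb a) x = refl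
rename-At ρ (atSg z) x = refl

module _ (L : Logic) where

  data RelRule : List LFormula → List Premiss → Eigen → Set where
    rRef : ∀ {a} → RelRule [] ((a ⊆ₗ a ∷ [] , []) ∷ []) noEigen
    rTr : ∀ {a b c} → RelRule (c ⊆ₗ b ∷ b ⊆ₗ a ∷ []) ((c ⊆ₗ a ∷ [] , []) ∷ []) noEigen
    rL⊆ : ∀ {x a b} → RelRule (x ∈ₗ a ∷ a ⊆ₗ b ∷ []) ((x ∈ₗ b ∷ [] , []) ∷ []) noEigen
    rN : ∀ {x k} → 1 ≤ rank (level L) → RelRule [] ((nv k ∈N x ∷ [] , []) ∷ []) (nbhdEigen k)
    r0 : ∀ {x y a} → 1 ≤ rank (level L) → RelRule (a ∈N x ∷ []) ((y ∈ₗ a ∷ [] , []) ∷ []) (worldEigen y)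
    rT : ∀ {x k} → 2 ≤ rank (level L) → RelRule [] ((x ∈ₗ nv k ∷ nv k ∈N x ∷ [] , []) ∷ []) (nbhdEigen k)
    rW : ∀ {x a} → 3 ≤ rank (level L) → RelRule (a ∈N x ∷ []) ((x ∈ₗ a ∷ [] , []) ∷ []) noEigen
    rSingle : ∀ {x} → level L ≡ lC → RelRule (sng x ∈N x ∷ []) ((x ∈ₗ sng x ∷ [] , []) ∷ []) noEigen
    rC : ∀ {x a} → level L ≡ lC → RelRule (a ∈N x ∷ []) ((sng x ∈N x ∷ sng x ⊆ₗ a ∷ [] , []) ∷ []) noEigen
    rRepl₁ : ∀ {x y} t → level L ≡ lC → RelRule (y ∈ₗ sng x ∷ At t x ∷ []) ((At t y ∷ [] , []) ∷ []) noEigen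
    rRepl₂ : ∀ {x y} t → level L ≡ lC → RelRule (y ∈ₗ sng x ∷ At t y ∷ []) ((At t x ∷ [] , []) ∷ []) noEigen
    rU₁ : ∀ {x y z a b k} → suffix L ≡ sU → RelRule (a ∈N x ∷ y ∈ₗ a ∷ b ∈N y ∷ z ∈ₗ b ∷ [])
            ((z ∈ₗ nv k ∷ nv k ∈N x ∷ [] , []) ∷ []) (nbhdEigen k)
    rU₂ : ∀ {x y z a b k} → suffix L ≡ sU → RelRule (a ∈N x ∷ y ∈ₗ a ∷ b ∈N x ∷ z ∈ₗ b ∷ [])
            ((z ∈ₗ nv k ∷ nv k ∈N y ∷ [] , []) ∷ []) (nbhdEigen k)
    rA₁ : ∀ {x y a b} → suffix L ≡ sA → RelRule (a ∈N x ∷ y ∈ₗ a ∷ b ∈N x ∷ []) ((b ∈N y ∷ [] , []) ∷ []) noEigen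
    rA₂ : ∀ {x y a b} → suffix L ≡ sA → RelRule (a ∈N x ∷ y ∈ₗ a ∷ b ∈N y ∷ []) ((b ∈N x ∷ [] , []) ∷ []) noEigen

  -- Rule pL pR mL mR ps e  stands for the rule with conclusion  pL ++ Γ ⇒ pR ++ Δ, where the side
  -- formulas mL, mR must occur in Γ, Δ (and are kept), premisses  aL ++ Γ ⇒ aR ++ Δ  for (aL , aR) ∈ ps,
  -- and eigenvariable e, which must be fresh for the conclusion.
  data Rule : List LFormula → List LFormula → List LFormula → List LFormula → List Premiss → Eigen → Set where
    rInit : ∀ {x p} → Rule [] [] (x ∶ atom p ∷ []) (x ∶ atom p ∷ []) [] noEigen
    rInit⊥ : ∀ {x} → Rule [] [] (x ∶ falsum ∷ []) [] [] noEigen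
    rL∧ : ∀ {x A B} → Rule (x ∶ (A ∧ᶠ B) ∷ []) [] [] [] ((x ∶ A ∷ x ∶ B ∷ [] , []) ∷ []) noEigen
    rR∧ : ∀ {x A B} → Rule [] (x ∶ (A ∧ᶠ B) ∷ []) [] [] (([] , x ∶ A ∷ []) ∷ ([] , x ∶ B ∷ []) ∷ []) noEigen
    rL∨ : ∀ {x A B} → Rule (x ∶ (A ∨ᶠ B) ∷ []) [] [] [] ((x ∶ A ∷ [] , []) ∷ (x ∶ B ∷ [] , []) ∷ []) noEigen
    rR∨ : ∀ {x A B} → Rule [] (x ∶ (A ∨ᶠ B) ∷ []) [] [] (([] , x ∶ A ∷ x ∶ B ∷ []) ∷ []) noEigen
    rL⊃ : ∀ {x A B} → Rule (x ∶ (A ⊃ B) ∷ []) [] [] [] (([] , x ∶ A ∷ []) ∷ (x ∶ B ∷ [] , []) ∷ []) noEigen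
    rR⊃ : ∀ {x A B} → Rule [] (x ∶ (A ⊃ B) ∷ []) [] [] ((x ∶ A ∷ [] , x ∶ B ∷ []) ∷ []) noEigen
    rL∀ : ∀ {x a A} → Rule [] [] (x ∈ₗ a ∷ a ⊩∀ A ∷ []) [] ((x ∶ A ∷ [] , []) ∷ []) noEigen
    rR∀ : ∀ {x a A} → Rule [] (a ⊩∀ A ∷ []) [] [] ((x ∈ₗ a ∷ [] , x ∶ A ∷ []) ∷ []) (worldEigen x)
    rL∃ : ∀ {x a A} → Rule (a ⊩∃ A ∷ []) [] [] [] ((x ∈ₗ a ∷ x ∶ A ∷ [] , []) ∷ []) (worldEigen x)
    rR∃ : ∀ {x a A} → Rule [] [] (x ∈ₗ a ∷ []) (a ⊩∃ A ∷ []) (([] , x ∶ A ∷ []) ∷ []) noEigen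
    rR> : ∀ {x k A B} → Rule [] (x ∶ (A > B) ∷ []) [] []
            ((nv k ∈N x ∷ nv k ⊩∃ A ∷ [] , x ⊩[ nv k ] A ∣ B ∷ []) ∷ []) (nbhdEigen k)
    rL> : ∀ {x a A B} → Rule [] [] (a ∈N x ∷ x ∶ (A > B) ∷ []) []
            (([] , a ⊩∃ A ∷ []) ∷ (x ⊩[ a ] A ∣ B ∷ [] , []) ∷ []) noEigen
    rR∣ : ∀ {x a c A B} → Rule [] [] (c ∈N x ∷ c ⊆ₗ a ∷ []) (x ⊩[ a ] A ∣ B ∷ [])
            (([] , c ⊩∃ A ∷ []) ∷ ([] , c ⊩∀ (A ⊃ B) ∷ []) ∷ []) noEigen
    rL∣ : ∀ {x a k A B} → Rule (x ⊩[ a ] A ∣ B ∷ []) [] [] []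
            ((nv k ∈N x ∷ nv k ⊆ₗ a ∷ nv k ⊩∃ A ∷ nv k ⊩∀ (A ⊃ B) ∷ [] , []) ∷ []) (nbhdEigen k)
    rRel : ∀ {mL ps e} → RelRule mL ps e → Rule [] [] mL [] ps e

  renameRelRule : ∀ {mL ps e} (ρ : Renaming) → RelRule mL ps e → (ok : KeepsNbhdVar ρ e) →
                  RelRule (renameAll ρ mL) (map (renamePremiss ρ) ps) (renameEigen ρ e ok)
  renameRelRule ρ rRef ok = rRef
  renameRelRule ρ rTr ok = rTr
  renameRelRule ρ rL⊆ ok = rL⊆
  renameRelRule ρ (rN h) (z , eq) rewrite eq = rN h
  renameRelRule ρ (r0 h) ok = r0 h
  renameRelRule ρ (rT h) (z , eq) rewrite eq = rT h
  renameRelRule ρ (rW h) ok = rW h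
  renameRelRule ρ (rSingle h) ok = rSingle h
  renameRelRule ρ (rC h) ok = rC h
  renameRelRule ρ (rRepl₁ {x} {y} t h) ok rewrite rename-At ρ t x | rename-At ρ t y = rRepl₁ (renameAtKind ρ t) h
  renameRelRule ρ (rRepl₂ {x} {y} t h) ok rewrite rename-At ρ t x | rename-At ρ t y = rRepl₂ (renameAtKind ρ t) h
  renameRelRule ρ (rU₁ h) (z , eq) rewrite eq = rU₁ h
  renameRelRule ρ (rU₂ h) (z , eq) rewrite eq = rU₂ h
  renameRelRule ρ (rA₁ h) ok = rA₁ h
  renameRelRule ρ (rA₂ h) ok = rA₂ h

  renameRule : ∀ {pL pR mL mR ps e} (ρ : Renaming) → Rule pL pR mL mR ps e → (ok : KeepsNbhdVar ρ e) →
               Rule (renameAll ρ pL) (renameAll ρ pR) (renameAll ρ mL) (renameAll ρ mR)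
                    (map (renamePremiss ρ) ps) (renameEigen ρ e ok)
  renameRule ρ rInit ok = rInit
  renameRule ρ rInit⊥ ok = rInit⊥
  renameRule ρ rL∧ ok = rL∧
  renameRule ρ rR∧ ok = rR∧
  renameRule ρ rL∨ ok = rL∨
  renameRule ρ rR∨ ok = rR∨
  renameRule ρ rL⊃ ok = rL⊃
  renameRule ρ rR⊃ ok = rR⊃
  renameRule ρ rL∀ ok = rL∀
  renameRule ρ rR∀ ok = rR∀
  renameRule ρ rL∃ ok = rL∃
  renameRule ρ rR∃ ok = rR∃
  renameRule ρ rR> (z , eq) rewrite eq = rR>
  renameRule ρ rL> ok = rL>
  renameRule ρ rR∣ ok = rR∣
  renameRule ρ rL∣ (z , eq) rewrite eq = rL∣
  renameRule ρ (rRel r) ok = rRel (renameRelRule ρ r ok)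

  -- Derivations are indexed by an upper bound on their height, for the height-preserving lemmas
  -- on which the cut induction rests.
  data Derivs (n : ℕ) (Γ Δ : List LFormula) : List Premiss → Set
  data Deriv : ℕ → List LFormula → List LFormula → Set

  data Derivs n Γ Δ where
    [] : Derivs n Γ Δ []
    _∷_ : ∀ {aL aR ps} → Deriv n (aL ++ Γ) (aR ++ Δ) → Derivs n Γ Δ ps → Derivs n Γ Δ ((aL , aR) ∷ ps)

  data Deriv where
    rule : ∀ {n Γ' Δ' Γ Δ pL pR mL mR ps e} → Rule pL pR mL mR ps e →
           Γ' ↭ pL ++ Γ → Δ' ↭ pR ++ Δ → All (_∈ Γ) mL → All (_∈ Δ) mR →
           FreshEigen e Γ' Δ' → Derivs n Γ Δ ps → Deriv (suc n) Γ' Δ'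

  permute : ∀ {n Γ Δ Γ' Δ'} → Deriv n Γ Δ → Γ ↭ Γ' → Δ ↭ Δ' → Deriv n Γ' Δ'
  permute (rule r p q mL mR fr ps) pΓ pΔ =
    rule r (↭-trans (↭-sym pΓ) p) (↭-trans (↭-sym pΔ) q) mL mR (All-resp-↭ (++⁺ pΓ pΔ) fr) ps

  castDeriv : ∀ {n Γ Δ Γ' Δ'} → Deriv n Γ Δ → Γ ≡ Γ' → Δ ≡ Δ' → Deriv n Γ' Δ'
  castDeriv d refl refl = d

  raise : ∀ {n m Γ Δ} → n ≤ m → Deriv n Γ Δ → Deriv m Γ Δ
  raiseAll : ∀ {n m Γ Δ ps} → n ≤ m → Derivs n Γ Δ ps → Derivs m Γ Δ ps
  raise (s≤s le) (rule r p q mL mR fr ps) = rule r p q mL mR fr (raiseAll le ps)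
  raiseAll le [] = []
  raiseAll le (d ∷ ps) = raise le d ∷ raiseAll le ps

  toCalculus : ∀ {n Γ Δ} → Deriv n Γ Δ → L ⊢ Γ ⇒ Δ
  toCalculusRel : ∀ {n Γ Δ mL ps e} → RelRule mL ps e → All (_∈ Γ) mL →
                  FreshEigen e Γ Δ → Derivs n Γ Δ ps → L ⊢ Γ ⇒ Δ
  toCalculusRule : ∀ {n Γ Δ pL pR mL mR ps e} → Rule pL pR mL mR ps e → All (_∈ Γ) mL → All (_∈ Δ) mR →
         FreshEigen e (pL ++ Γ) (pR ++ Δ) → Derivs n Γ Δ ps → L ⊢ pL ++ Γ ⇒ pR ++ Δ
  toCalculus (rule r p q mL mR fr ps) = exch (↭-sym p) (↭-sym q) (toCalculusRule r mL mR (All-resp-↭ (++⁺ p q) fr) ps)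
  toCalculusRule rInit (m ∷ []) (m' ∷ []) fr [] = init m m'
  toCalculusRule rInit⊥ (m ∷ []) [] fr [] = init⊥ m
  toCalculusRule rL∧ [] [] fr (d ∷ []) = L∧ (toCalculus d)
  toCalculusRule rR∧ [] [] fr (d1 ∷ d2 ∷ []) = R∧ (toCalculus d1) (toCalculus d2)
  toCalculusRule rL∨ [] [] fr (d1 ∷ d2 ∷ []) = L∨ (toCalculus d1) (toCalculus d2)
  toCalculusRule rR∨ [] [] fr (d ∷ []) = R∨ (toCalculus d)
  toCalculusRule rL⊃ [] [] fr (d1 ∷ d2 ∷ []) = L⊃ (toCalculus d1) (toCalculus d2)
  toCalculusRule rR⊃ [] [] fr (d ∷ []) = R⊃ (toCalculus d)
  toCalculusRule rL∀ (m1 ∷ m2 ∷ []) [] fr (d ∷ []) = L∀ m1 m2 (toCalculus d)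
  toCalculusRule rR∀ [] [] fr (d ∷ []) = R∀ fr (toCalculus d)
  toCalculusRule rL∃ [] [] fr (d ∷ []) = L∃ fr (toCalculus d)
  toCalculusRule rR∃ (m1 ∷ []) (m2 ∷ []) fr (d ∷ []) = R∃ m1 m2 (toCalculus d)
  toCalculusRule rR> [] [] fr (d ∷ []) = R> fr (toCalculus d)
  toCalculusRule rL> (m1 ∷ m2 ∷ []) [] fr (d1 ∷ d2 ∷ []) = L> m1 m2 (toCalculus d1) (toCalculus d2)
  toCalculusRule rR∣ (m1 ∷ m2 ∷ []) (m3 ∷ []) fr (d1 ∷ d2 ∷ []) = R∣ m1 m2 m3 (toCalculus d1) (toCalculus d2)
  toCalculusRule rL∣ [] [] fr (d ∷ []) = L∣ fr (toCalculus d)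
  toCalculusRule (rRel r) mL [] fr ds = toCalculusRel r mL fr ds
  toCalculusRel rRef [] fr (d ∷ []) = Ref (toCalculus d)
  toCalculusRel rTr (m1 ∷ m2 ∷ []) fr (d ∷ []) = Tr m1 m2 (toCalculus d)
  toCalculusRel rL⊆ (m1 ∷ m2 ∷ []) fr (d ∷ []) = L⊆ m1 m2 (toCalculus d)
  toCalculusRel (rN h) [] fr (d ∷ []) = ruleN h fr (toCalculus d)
  toCalculusRel (r0 h) (m ∷ []) fr (d ∷ []) = rule0 h m fr (toCalculus d)
  toCalculusRel (rT h) [] fr (d ∷ []) = ruleT h fr (toCalculus d)
  toCalculusRel (rW h) (m ∷ []) fr (d ∷ []) = ruleW h m (toCalculus d)
  toCalculusRel (rSingle h) (m ∷ []) fr (d ∷ []) = ruleSingle h m (toCalculus d)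
  toCalculusRel (rC h) (m ∷ []) fr (d ∷ []) = ruleC h m (toCalculus d)
  toCalculusRel (rRepl₁ t h) (m1 ∷ m2 ∷ []) fr (d ∷ []) = Repl₁ t h m1 m2 (toCalculus d)
  toCalculusRel (rRepl₂ t h) (m1 ∷ m2 ∷ []) fr (d ∷ []) = Repl₂ t h m1 m2 (toCalculus d)
  toCalculusRel (rU₁ h) (m1 ∷ m2 ∷ m3 ∷ m4 ∷ []) fr (d ∷ []) = ruleU₁ h m1 m2 m3 m4 fr (toCalculus d)
  toCalculusRel (rU₂ h) (m1 ∷ m2 ∷ m3 ∷ m4 ∷ []) fr (d ∷ []) = ruleU₂ h m1 m2 m3 m4 fr (toCalculus d)
  toCalculusRel (rA₁ h) (m1 ∷ m2 ∷ m3 ∷ []) fr (d ∷ []) = ruleA₁ h m1 m2 m3 (toCalculus d)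
  toCalculusRel (rA₂ h) (m1 ∷ m2 ∷ m3 ∷ []) fr (d ∷ []) = ruleA₂ h m1 m2 m3 (toCalculus d)

  renameMembers : ∀ {Γ : List LFormula} (ρ : Renaming) Θ {ms} → All (_∈ Γ) ms → All (_∈ renameAll ρ Γ ++ Θ) (renameAll ρ ms)
  renameMembers ρ Θ [] = []
  renameMembers ρ Θ (m ∷ ms) = ∈-++⁺ˡ (∈-map⁺ (rename ρ) m) ∷ renameMembers ρ Θ ms

  renameAll-agree : ∀ (ρ ρ' : Renaming) (P : LFormula → Set) Γ → All P Γ →
      (∀ φ → P φ → rename ρ' φ ≡ rename ρ φ) → renameAll ρ' Γ ≡ renameAll ρ Γ
  renameAll-agree ρ ρ' P [] [] f = refl
  renameAll-agree ρ ρ' P (φ ∷ Γ) (a ∷ as) f = cong₂ _∷_ (f φ a) (renameAll-agree ρ ρ' P Γ as f)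

  renameAll-++ : ∀ ρ aL Γ Θ → renameAll ρ (aL ++ Γ) ++ Θ ≡ renameAll ρ aL ++ (renameAll ρ Γ ++ Θ)
  renameAll-++ ρ aL Γ Θ = trans (cong (_++ Θ) (map-++ (rename ρ) aL Γ)) (++-assoc (renameAll ρ aL) (renameAll ρ Γ) Θ)

  weakenRename : ∀ n {Γ Δ} (ρ : Renaming) (Θ Λ : List LFormula) → Deriv n Γ Δ → Deriv n (renameAll ρ Γ ++ Θ) (renameAll ρ Δ ++ Λ)
  weakenRenameAll : ∀ n {Γ Δ ps} (ρ : Renaming) (Θ Λ : List LFormula) → Derivs n Γ Δ ps →
         Derivs n (renameAll ρ Γ ++ Θ) (renameAll ρ Δ ++ Λ) (map (renamePremiss ρ) ps)
  weakenRename (suc n) {Γ'} {Δ'} ρ Θ Λ (rule {Γ = Γ} {Δ} {pL} {pR} {e = e} r p q mL mR fr ps)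
    with freshenEigen e ρ (renameAll ρ Γ' ++ Θ) (renameAll ρ Δ' ++ Λ)
  ... | ρ' , ok , fr' , ag =
    rule (renameRule ρ' r ok) pΓ pΔ (renameMembers ρ' Θ mL) (renameMembers ρ' Λ mR) fr' (weakenRenameAll n ρ' Θ Λ ps)
    where
      frΓ : All (λ φ → ¬ occEigen e φ) Γ'
      frΓ = ++⁻ˡ Γ' fr
      frΔ : All (λ φ → ¬ occEigen e φ) Δ'
      frΔ = ++⁻ʳ Γ' fr
      pΓ : renameAll ρ Γ' ++ Θ ↭ renameAll ρ' pL ++ (renameAll ρ' Γ ++ Θ)
      pΓ = ↭-trans (↭-reflexive (cong (_++ Θ) (sym (renameAll-agree ρ ρ' _ Γ' frΓ ag))))
             (↭-trans (++⁺ʳ Θ (map⁺ (rename ρ') p)) (↭-reflexive (renameAll-++ ρ' pL Γ Θ)))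
      pΔ : renameAll ρ Δ' ++ Λ ↭ renameAll ρ' pR ++ (renameAll ρ' Δ ++ Λ)
      pΔ = ↭-trans (↭-reflexive (cong (_++ Λ) (sym (renameAll-agree ρ ρ' _ Δ' frΔ ag))))
             (↭-trans (++⁺ʳ Λ (map⁺ (rename ρ') q)) (↭-reflexive (renameAll-++ ρ' pR Δ Λ)))
  weakenRenameAll n ρ Θ Λ [] = []
  weakenRenameAll n {Γ} {Δ} ρ Θ Λ (_∷_ {aL} {aR} d ps) =
    castDeriv (weakenRename n ρ Θ Λ d) (renameAll-++ ρ aL Γ Θ) (renameAll-++ ρ aR Δ Λ) ∷ weakenRenameAll n ρ Θ Λ ps

  weaken : ∀ {n Γ Δ} (Θ Λ : List LFormula) → Deriv n Γ Δ → Deriv n (Γ ++ Θ) (Δ ++ Λ)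
  weaken {n} {Γ} {Δ} Θ Λ d = castDeriv (weakenRename n idRen Θ Λ d) (cong (_++ Θ) (renameAll-id Γ)) (cong (_++ Λ) (renameAll-id Δ))

  renameDeriv : ∀ {n Γ Δ} (ρ : Renaming) → Deriv n Γ Δ → Deriv n (renameAll ρ Γ) (renameAll ρ Δ)
  renameDeriv {n} {Γ} {Δ} ρ d = castDeriv (weakenRename n ρ [] [] d) (++-identityʳ _) (++-identityʳ _)

  isLeftPrincipal : LFormula → Bool
  isLeftPrincipal (x ∶ (A ∧ᶠ B)) = true
  isLeftPrincipal (x ∶ (A ∨ᶠ B)) = true
  isLeftPrincipal (x ∶ (A ⊃ B)) = true
  isLeftPrincipal (a ⊩∃ A) = true
  isLeftPrincipal (x ⊩[ a ] A ∣ B) = true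
  isLeftPrincipal _ = false

  isRightPrincipal : LFormula → Bool
  isRightPrincipal (x ∶ (A ∧ᶠ B)) = true
  isRightPrincipal (x ∶ (A ∨ᶠ B)) = true
  isRightPrincipal (x ∶ (A ⊃ B)) = true
  isRightPrincipal (x ∶ (A > B)) = true
  isRightPrincipal (a ⊩∀ A) = true
  isRightPrincipal _ = false

  data Shape : List LFormula → List LFormula → List LFormula → List LFormula → Set where
    noPrincipal : ∀ {mL mR} → Shape [] [] mL mR
    leftPrincipal : ∀ {χ} → isLeftPrincipal χ ≡ true → Shape (χ ∷ []) [] [] []
    rightPrincipal : ∀ {χ} → isRightPrincipal χ ≡ true → Shape [] (χ ∷ []) [] []

  NotLeftPrincipal : LFormula → Set
  NotLeftPrincipal ψ = isLeftPrincipal ψ ≡ false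

  NotRightPrincipal : LFormula → Set
  NotRightPrincipal ψ = isRightPrincipal ψ ≡ false

  shape : ∀ {pL pR mL mR ps e} → Rule pL pR mL mR ps e → Shape pL pR mL mR
  shape rInit = noPrincipal
  shape rInit⊥ = noPrincipal
  shape rL∧ = leftPrincipal refl
  shape rR∧ = rightPrincipal refl
  shape rL∨ = leftPrincipal refl
  shape rR∨ = rightPrincipal refl
  shape rL⊃ = leftPrincipal refl
  shape rR⊃ = rightPrincipal refl
  shape rL∀ = noPrincipal
  shape rR∀ = rightPrincipal refl
  shape rL∃ = leftPrincipal refl
  shape rR∃ = noPrincipal
  shape rR> = rightPrincipal refl
  shape rL> = noPrincipal
  shape rR∣ = noPrincipal
  shape rL∣ = leftPrincipal refl
  shape (rRel _) = noPrincipal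

  hasRightRule : LFormula → Bool
  hasRightRule (x ∶ (A ∧ᶠ B)) = true
  hasRightRule (x ∶ (A ∨ᶠ B)) = true
  hasRightRule (x ∶ (A ⊃ B)) = true
  hasRightRule (x ∶ (A > B)) = true
  hasRightRule (a ⊩∃ A) = true
  hasRightRule (a ⊩∀ A) = true
  hasRightRule (x ⊩[ a ] A ∣ B) = true
  hasRightRule _ = false

  NoRightRules : List LFormula → Set
  NoRightRules = All (λ ψ → hasRightRule ψ ≡ false)

  noRightRule⇒notLeftPrincipal : ∀ ψ → hasRightRule ψ ≡ false → NotLeftPrincipal ψ
  noRightRule⇒notLeftPrincipal (x ∶ atom p) _ = refl
  noRightRule⇒notLeftPrincipal (x ∶ falsum) _ = refl
  noRightRule⇒notLeftPrincipal (a ∈N x) _ = refl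
  noRightRule⇒notLeftPrincipal (x ∈ₗ a) _ = refl
  noRightRule⇒notLeftPrincipal (a ⊆ₗ b) _ = refl
  noRightRule⇒notLeftPrincipal (a ⊩∀ A) _ = refl
  noRightRule⇒notLeftPrincipal (x ∶ (A > B)) _ = refl
  noRightRule⇒notLeftPrincipal (x ∶ (A ∧ᶠ B)) ()
  noRightRule⇒notLeftPrincipal (x ∶ (A ∨ᶠ B)) ()
  noRightRule⇒notLeftPrincipal (x ∶ (A ⊃ B)) ()
  noRightRule⇒notLeftPrincipal (a ⊩∃ A) ()
  noRightRule⇒notLeftPrincipal (x ⊩[ a ] A ∣ B) ()

  At-noRightRule : ∀ t x → hasRightRule (At t x) ≡ false
  At-noRightRule (atP P) x = refl
  At-noRightRule (atIn a) x = refl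
  At-noRightRule (atNb a) x = refl
  At-noRightRule (atSg z) x = refl

  relational-noRightRules : ∀ {mL ps e} → RelRule mL ps e → NoRightRules mL
  relational-noRightRules rRef = []
  relational-noRightRules rTr = refl ∷ refl ∷ []
  relational-noRightRules rL⊆ = refl ∷ refl ∷ []
  relational-noRightRules (rN _) = []
  relational-noRightRules (r0 _) = refl ∷ []
  relational-noRightRules (rT _) = []
  relational-noRightRules (rW _) = refl ∷ []
  relational-noRightRules (rSingle _) = refl ∷ []
  relational-noRightRules (rC _) = refl ∷ []
  relational-noRightRules (rRepl₁ {x} t _) = refl ∷ At-noRightRule t x ∷ []
  relational-noRightRules (rRepl₂ {y = y} t _) = refl ∷ At-noRightRule t y ∷ []
  relational-noRightRules (rU₁ _) = refl ∷ refl ∷ refl ∷ refl ∷ []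
  relational-noRightRules (rU₂ _) = refl ∷ refl ∷ refl ∷ refl ∷ []
  relational-noRightRules (rA₁ _) = refl ∷ refl ∷ refl ∷ []
  relational-noRightRules (rA₂ _) = refl ∷ refl ∷ refl ∷ []

  data RightSideRule : List LFormula → List LFormula → List LFormula → List LFormula → List Premiss → Set where
    sideInit : ∀ {x p} → RightSideRule [] [] (x ∶ atom p ∷ []) (x ∶ atom p ∷ []) []
    sideR∃ : ∀ {x a A} → RightSideRule [] [] (x ∈ₗ a ∷ []) (a ⊩∃ A ∷ []) (([] , x ∶ A ∷ []) ∷ [])
    sideR∣ : ∀ {x a c A B} → RightSideRule [] [] (c ∈N x ∷ c ⊆ₗ a ∷ []) (x ⊩[ a ] A ∣ B ∷ [])
            (([] , c ⊩∃ A ∷ []) ∷ ([] , c ⊩∀ (A ⊃ B) ∷ []) ∷ [])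

  rightSide-classify : ∀ {pL pR mL mR ps e} → Rule pL pR mL mR ps e → (mR ≡ []) ⊎ RightSideRule pL pR mL mR ps
  rightSide-classify rInit = inj₂ sideInit
  rightSide-classify rR∃ = inj₂ sideR∃
  rightSide-classify rR∣ = inj₂ sideR∣
  rightSide-classify rInit⊥ = inj₁ refl
  rightSide-classify rL∧ = inj₁ refl
  rightSide-classify rR∧ = inj₁ refl
  rightSide-classify rL∨ = inj₁ refl
  rightSide-classify rR∨ = inj₁ refl
  rightSide-classify rL⊃ = inj₁ refl
  rightSide-classify rR⊃ = inj₁ refl
  rightSide-classify rL∀ = inj₁ refl
  rightSide-classify rR∀ = inj₁ refl
  rightSide-classify rL∃ = inj₁ refl
  rightSide-classify rR> = inj₁ refl
  rightSide-classify rL> = inj₁ refl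
  rightSide-classify rL∣ = inj₁ refl
  rightSide-classify (rRel _) = inj₁ refl

  data LeftSideRule : List LFormula → List LFormula → List LFormula → List LFormula → List Premiss → Set where
    sideL∀ : ∀ {x a A} → LeftSideRule [] [] (x ∈ₗ a ∷ a ⊩∀ A ∷ []) [] ((x ∶ A ∷ [] , []) ∷ [])
    sideL> : ∀ {x a A B} → LeftSideRule [] [] (a ∈N x ∷ x ∶ (A > B) ∷ []) []
               (([] , a ⊩∃ A ∷ []) ∷ (x ⊩[ a ] A ∣ B ∷ [] , []) ∷ [])

  leftSide-classify : ∀ {pL pR mL mR ps e} → Rule pL pR mL mR ps e → NoRightRules mL ⊎ LeftSideRule pL pR mL mR ps
  leftSide-classify rL∀ = inj₂ sideL∀
  leftSide-classify rL> = inj₂ sideL>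
  leftSide-classify rInit = inj₁ (refl ∷ [])
  leftSide-classify rInit⊥ = inj₁ (refl ∷ [])
  leftSide-classify rL∧ = inj₁ []
  leftSide-classify rR∧ = inj₁ []
  leftSide-classify rL∨ = inj₁ []
  leftSide-classify rR∨ = inj₁ []
  leftSide-classify rL⊃ = inj₁ []
  leftSide-classify rR⊃ = inj₁ []
  leftSide-classify rR∀ = inj₁ []
  leftSide-classify rL∃ = inj₁ []
  leftSide-classify rR∃ = inj₁ (refl ∷ [])
  leftSide-classify rR> = inj₁ []
  leftSide-classify rR∣ = inj₁ (refl ∷ refl ∷ [])
  leftSide-classify rL∣ = inj₁ []
  leftSide-classify (rRel r) = inj₁ (relational-noRightRules r)

  sideL-notPrincipal : ∀ {pL pR mL mR ps e} → Rule pL pR mL mR ps e → All NotLeftPrincipal mL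
  sideL-notPrincipal r with leftSide-classify r
  ... | inj₁ noRight = All.map (noRightRule⇒notLeftPrincipal _) noRight
  ... | inj₂ sideL∀ = refl ∷ refl ∷ []
  ... | inj₂ sideL> = refl ∷ refl ∷ []

  sideR-notPrincipal : ∀ {pL pR mL mR ps e} → Rule pL pR mL mR ps e → All NotRightPrincipal mR
  sideR-notPrincipal r with rightSide-classify r
  ... | inj₁ refl = []
  ... | inj₂ sideInit = refl ∷ []
  ... | inj₂ sideR∃ = refl ∷ []
  ... | inj₂ sideR∣ = refl ∷ []

  ↭-uncons : ∀ {y z : LFormula} {xs ys} → y ∷ xs ↭ z ∷ ys → ¬ y ≡ z →
             Σ (List LFormula) λ zs → (xs ↭ z ∷ zs) × (ys ↭ y ∷ zs)
  ↭-uncons {y} {z} {xs} {ys} p ne with ∈-resp-↭ (↭-sym p) (here refl)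
  ... | here eq = ⊥-elim (ne (sym eq))
  ... | there m with ∈-∃++ m
  ... | us , vs , refl = (us ++ vs) , shift z us vs ,
        drop-∷ (↭-trans (↭-sym p) (↭-trans (prep y (shift z us vs)) (swap y z ↭-refl)))

  data Differs (y : LFormula) : List LFormula → Set where
    differs[] : Differs y []
    differs∷ : ∀ {χ} → ¬ y ≡ χ → Differs y (χ ∷ [])

  splitContext : ∀ {y Γ pL Γ₀} → y ∷ Γ ↭ pL ++ Γ₀ → Differs y pL →
             Σ (List LFormula) λ Θ → (Γ₀ ↭ y ∷ Θ) × (Γ ↭ pL ++ Θ)
  splitContext {Γ = Γ} p differs[] = Γ , ↭-sym p , ↭-refl
  splitContext p (differs∷ ne) with ↭-uncons p ne
  ... | zs , q , r = zs , r , q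

  ∈-drop : ∀ {ψ y : LFormula} {Γ₀ Θ} → ψ ∈ Γ₀ → Γ₀ ↭ y ∷ Θ → ¬ ψ ≡ y → ψ ∈ Θ
  ∈-drop m p ne with ∈-resp-↭ p m
  ... | here eq = ⊥-elim (ne eq)
  ... | there m' = m'

  ∈-drop-dup : ∀ {ψ y : LFormula} {Γ₀ Θ} → ψ ∈ Γ₀ → Γ₀ ↭ y ∷ Θ → y ∈ Θ → ψ ∈ Θ
  ∈-drop-dup m p yi with ∈-resp-↭ p m
  ... | here refl = yi
  ... | there m' = m'

  All-drop : ∀ {P : LFormula → Set} Γ {ψ Δ} → All P (Γ ++ ψ ∷ Δ) → All P (Γ ++ Δ)
  All-drop [] (_ ∷ a) = a
  All-drop (x ∷ Γ) (px ∷ a) = px ∷ All-drop Γ a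

  ≢-by : ∀ {ψ χ : LFormula} (f : LFormula → Bool) → f ψ ≡ false → f χ ≡ true → ¬ ψ ≡ χ
  ≢-by f a b refl with trans (sym a) b
  ... | ()

  premissFormulas : List Premiss → List LFormula
  premissFormulas [] = []
  premissFormulas ((aL , aR) ∷ ps) = aL ++ aR ++ premissFormulas ps

  premissFormulasˡ : ∀ {x ps aL aR} → (aL , aR) ∈ ps → x ∈ aL → x ∈ premissFormulas ps
  premissFormulasˡ {ps = (aL , aR) ∷ ps} (here refl) m = ∈-++⁺ˡ m
  premissFormulasˡ {ps = (bL , bR) ∷ ps} (there i) m = ∈-++⁺ʳ bL (∈-++⁺ʳ bR (premissFormulasˡ i m))

  premissFormulasʳ : ∀ {x ps aL aR} → (aL , aR) ∈ ps → x ∈ aR → x ∈ premissFormulas ps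
  premissFormulasʳ {ps = (aL , aR) ∷ ps} (here refl) m = ∈-++⁺ʳ aL (∈-++⁺ˡ m)
  premissFormulasʳ {ps = (bL , bR) ∷ ps} (there i) m = ∈-++⁺ʳ bL (∈-++⁺ʳ bR (premissFormulasʳ i m))

  mapDerivs : ∀ {n m Γ Δ Γ' Δ' ps} →
              (∀ {aL aR} → Deriv n (aL ++ Γ) (aR ++ Δ) → Deriv m (aL ++ Γ') (aR ++ Δ')) →
              Derivs n Γ Δ ps → Derivs m Γ' Δ' ps
  mapDerivs f [] = []
  mapDerivs f (d ∷ ds) = f d ∷ mapDerivs f ds

  permuteAll : ∀ {n Γ Δ Γ' Δ' ps} → Derivs n Γ Δ ps → Γ ↭ Γ' → Δ ↭ Δ' → Derivs n Γ' Δ' ps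
  permuteAll ds p q = mapDerivs (λ {aL} {aR} d → permute d (++⁺ˡ aL p) (++⁺ˡ aR q)) ds

  lookupDerivs : ∀ {n Γ Δ ps p} → Derivs n Γ Δ ps → p ∈ ps → Deriv n (proj₁ p ++ Γ) (proj₂ p ++ Δ)
  lookupDerivs (d ∷ ps) (here refl) = d
  lookupDerivs (d ∷ ps) (there m) = lookupDerivs ps m

  tabulateDerivs : ∀ {n Γ Δ} (ps : List Premiss) → (∀ {p} → p ∈ ps → Deriv n (proj₁ p ++ Γ) (proj₂ p ++ Δ)) →
                   Derivs n Γ Δ ps
  tabulateDerivs [] f = []
  tabulateDerivs ((aL , aR) ∷ ps) f = f (here refl) ∷ tabulateDerivs ps (λ m → f (there m))

  differsL : ∀ {ψ pL pR mL mR ps e} → NotLeftPrincipal ψ → Rule pL pR mL mR ps e → Differs ψ pL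
  differsL nr r with shape r
  ... | noPrincipal = differs[]
  ... | leftPrincipal rm = differs∷ (≢-by isLeftPrincipal nr rm)
  ... | rightPrincipal _ = differs[]

  differsR : ∀ {ψ pL pR mL mR ps e} → NotRightPrincipal ψ → Rule pL pR mL mR ps e → Differs ψ pR
  differsR nr r with shape r
  ... | noPrincipal = differs[]
  ... | rightPrincipal rm = differs∷ (≢-by isRightPrincipal nr rm)
  ... | leftPrincipal _ = differs[]

  -- A formula that is never left-principal only ever serves as a side formula, so a duplicate of it
  -- can be dropped throughout the derivation.
  contractL : ∀ n {ψ Γ Δ} → Deriv n (ψ ∷ Γ) Δ → ψ ∈ Γ → NotLeftPrincipal ψ → Deriv n Γ Δ
  contractL (suc n) {ψ} {Γ} (rule {pL = pL} r p q mL mR fr prs) ψ∈Γ nr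
    with splitContext p (differsL nr r)
  ... | Θ , p₀ , p₁ = rule r p₁ q (All.map (λ m → ∈-drop-dup m p₀ ψ∈Θ) mL) mR (All.tail fr)
                        (mapDerivs (λ {aL} d → contractL n (permute d (↭-trans (++⁺ˡ aL p₀) (shift ψ aL Θ)) ↭-refl)
                                                          (∈-++⁺ʳ aL ψ∈Θ) nr) prs)
    where
      ψ∈Θ : ψ ∈ Θ
      ψ∈Θ with ∈-++⁻ pL (∈-resp-↭ p₁ ψ∈Γ) | shape r
      ... | inj₂ m | _ = m
      ... | inj₁ (here refl) | leftPrincipal rm = ⊥-elim (≢-by isLeftPrincipal nr rm refl)

  contractR : ∀ n {ψ Γ Δ} → Deriv n Γ (ψ ∷ Δ) → ψ ∈ Δ → NotRightPrincipal ψ → Deriv n Γ Δ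
  contractR (suc n) {ψ} {Γ} {Δ} (rule {pR = pR} r p q mL mR fr prs) ψ∈Δ nr
    with splitContext q (differsR nr r)
  ... | Θ , q₀ , q₁ = rule r p q₁ mL (All.map (λ m → ∈-drop-dup m q₀ ψ∈Θ) mR) (All-drop Γ fr)
                        (mapDerivs (λ {_} {aR} d → contractR n (permute d ↭-refl (↭-trans (++⁺ˡ aR q₀) (shift ψ aR Θ)))
                                                              (∈-++⁺ʳ aR ψ∈Θ) nr) prs)
    where
      ψ∈Θ : ψ ∈ Θ
      ψ∈Θ with ∈-++⁻ pR (∈-resp-↭ q₁ ψ∈Δ) | shape r
      ... | inj₂ m | _ = m
      ... | inj₁ (here refl) | rightPrincipal rm = ⊥-elim (≢-by isRightPrincipal nr rm refl)

  renameAll-fixes : ∀ (ρ : Renaming) (P : LFormula → Set) X → All P X →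
                    (∀ φ → P φ → rename ρ φ ≡ rename idRen φ) → renameAll ρ X ≡ X
  renameAll-fixes ρ P X a f = trans (renameAll-agree idRen ρ P X a f) (renameAll-id X)

  setWorld-fixes : ∀ z y {Γ} → All (λ φ → ¬ occW z φ) Γ → renameAll (setWorld idRen z y) Γ ≡ Γ
  setWorld-fixes z y fr = renameAll-fixes _ _ _ fr (setWorld-fresh idRen z y)

  setNbhd-fixes : ∀ k c {Γ} → All (λ φ → ¬ occN k φ) Γ → renameAll (setNbhd idRen k c) Γ ≡ Γ
  setNbhd-fixes k c fr = renameAll-fixes _ _ _ fr (setNbhd-fresh idRen k c)

  renameDerivs-fixing : ∀ {n Γ Δ ps} ρ → renameAll ρ Γ ≡ Γ → renameAll ρ Δ ≡ Δ →
                        Derivs n Γ Δ ps → Derivs n Γ Δ (map (renamePremiss ρ) ps)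
  renameDerivs-fixing {n} ρ fixΓ fixΔ ds =
    subst₂ (λ X Y → Derivs n X Y _) (trans (++-identityʳ _) fixΓ) (trans (++-identityʳ _) fixΔ)
           (weakenRenameAll n ρ [] [] ds)

  castRule : ∀ {a b c d a' b' c' d' ps e} → Rule a b c d ps e → a ≡ a' → b ≡ b' → c ≡ c' → d ≡ d' →
             Rule a' b' c' d' ps e
  castRule r refl refl refl refl = r

  -- Renaming the eigenvariable of a rule instance away from X leaves its conclusion untouched,
  -- because the eigenvariable is fresh for the conclusion.
  refreshInstance : ∀ {n Γ Δ Γ₀ Δ₀ pL pR mL mR ps e} (X : List LFormula) → Rule pL pR mL mR ps e →
                    Γ ↭ pL ++ Γ₀ → Δ ↭ pR ++ Δ₀ → All (_∈ Γ₀) mL → All (_∈ Δ₀) mR → FreshEigen e Γ Δ →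
                    Derivs n Γ₀ Δ₀ ps →
                    Σ (List Premiss) λ ps′ → Σ Eigen λ e′ →
                      Rule pL pR mL mR ps′ e′ × All (λ φ → ¬ occEigen e′ φ) X × Derivs n Γ₀ Δ₀ ps′
  refreshInstance {Γ = Γ} {Δ} {pL = pL} {pR} {ps = ps} {e} X s p q mL mR fr prs
    with freshenEigen e idRen X []
  ... | σ , ok , fresh , agree =
    map (renamePremiss σ) ps , renameEigen σ e ok ,
    castRule (renameRule σ s ok) (fixes (λ m → inΓ (∈-++⁺ˡ m))) (fixes (λ m → inΔ (∈-++⁺ˡ m)))
             (fixes (λ m → inΓ₀ (All.lookup mL m))) (fixes (λ m → inΔ₀ (All.lookup mR m))) ,
    ++⁻ˡ X fresh ,
    renameDerivs-fixing σ (fixes inΓ₀) (fixes inΔ₀) prs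
    where
      inΓ : ∀ {φ} → φ ∈ pL ++ _ → φ ∈ Γ ++ Δ
      inΓ m = ∈-++⁺ˡ (∈-resp-↭ (↭-sym p) m)
      inΔ : ∀ {φ} → φ ∈ pR ++ _ → φ ∈ Γ ++ Δ
      inΔ m = ∈-++⁺ʳ Γ (∈-resp-↭ (↭-sym q) m)
      inΓ₀ : ∀ {φ} → φ ∈ _ → φ ∈ Γ ++ Δ
      inΓ₀ m = inΓ (∈-++⁺ʳ pL m)
      inΔ₀ : ∀ {φ} → φ ∈ _ → φ ∈ Γ ++ Δ
      inΔ₀ m = inΔ (∈-++⁺ʳ pR m)
      fixes : ∀ {Y} → Y ⊆ Γ ++ Δ → renameAll σ Y ≡ Y
      fixes Y⊆ = renameAll-fixes σ _ _ (anti-mono Y⊆ fr) agree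

  premissContext⊆ : ∀ {Γ Δ Γ' Δ' aL aR ps} → (aL , aR) ∈ ps → Γ' ⊆ Γ → Δ' ⊆ Δ →
                    (aL ++ Γ') ++ (aR ++ Δ') ⊆ Γ ++ Δ ++ premissFormulas ps
  premissContext⊆ {Γ} {Δ} {Γ'} {Δ'} {aL} {aR} {ps} j Γ'⊆ Δ'⊆ m with ∈-++⁻ (aL ++ Γ') m
  ... | inj₁ m' with ∈-++⁻ aL m'
  ...   | inj₁ u = ∈-++⁺ʳ Γ (∈-++⁺ʳ Δ (premissFormulasˡ j u))
  ...   | inj₂ u = ∈-++⁺ˡ (Γ'⊆ u)
  premissContext⊆ {Γ} {Δ} {aR = aR} j Γ'⊆ Δ'⊆ m | inj₂ m' with ∈-++⁻ aR m'
  ...   | inj₁ u = ∈-++⁺ʳ Γ (∈-++⁺ʳ Δ (premissFormulasʳ j u))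
  ...   | inj₂ u = ∈-++⁺ʳ Γ (∈-++⁺ˡ (Δ'⊆ u))

  eigenSwap : Eigen → Eigen → Renaming
  eigenSwap (worldEigen y) (worldEigen x) = setWorld idRen y x
  eigenSwap (nbhdEigen k) (nbhdEigen j) = setNbhd idRen k (nv j)
  eigenSwap _ _ = idRen

  eigenSwap-fresh : ∀ e' e φ → ¬ occEigen e' φ → rename (eigenSwap e' e) φ ≡ φ
  eigenSwap-fresh noEigen e φ h = rename-id φ
  eigenSwap-fresh (worldEigen y) noEigen φ h = rename-id φ
  eigenSwap-fresh (worldEigen y) (worldEigen x) φ h = trans (setWorld-fresh idRen y x φ h) (rename-id φ)
  eigenSwap-fresh (worldEigen y) (nbhdEigen x) φ h = rename-id φ
  eigenSwap-fresh (nbhdEigen k) noEigen φ h = rename-id φ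
  eigenSwap-fresh (nbhdEigen k) (worldEigen x) φ h = rename-id φ
  eigenSwap-fresh (nbhdEigen k) (nbhdEigen j) φ h = trans (setNbhd-fresh idRen k (nv j) φ h) (rename-id φ)

  eigenSwap-fixes : ∀ e' e X → All (λ φ → ¬ occEigen e' φ) X → renameAll (eigenSwap e' e) X ≡ X
  eigenSwap-fixes e' e X a = trans (renameAll-agree idRen (eigenSwap e' e) _ X a
                                      (λ φ h → trans (eigenSwap-fresh e' e φ h) (sym (rename-id φ))))
                                   (renameAll-id X)

  samePremissesL : ∀ {χ mL mR ps e mL' mR' ps' e'} → Rule (χ ∷ []) [] mL mR ps e → Rule (χ ∷ []) [] mL' mR' ps' e' →
                   ¬ occEigen e' χ → ps ≡ map (renamePremiss (eigenSwap e' e)) ps'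
  samePremissesL rL∧ rL∧ h = refl
  samePremissesL rL∨ rL∨ h = refl
  samePremissesL rL⊃ rL⊃ h = refl
  samePremissesL (rL∃ {x} {a}) (rL∃ {x'}) h
    rewrite setWorld-≡ idRen x' x | setWorld-freshN idRen x' x a h | renameN-id a = refl
  samePremissesL (rL∣ {a = a} {k}) (rL∣ {k = k'}) h
    rewrite setNbhd-≡ idRen k' (nv k) | setNbhd-freshN idRen k' (nv k) a h | renameN-id a = refl

  samePremissesR : ∀ {χ mL mR ps e mL' mR' ps' e'} → Rule [] (χ ∷ []) mL mR ps e → Rule [] (χ ∷ []) mL' mR' ps' e' →
                   ¬ occEigen e' χ → ps ≡ map (renamePremiss (eigenSwap e' e)) ps'
  samePremissesR rR∧ rR∧ h = refl
  samePremissesR rR∨ rR∨ h = refl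
  samePremissesR rR⊃ rR⊃ h = refl
  samePremissesR (rR∀ {x} {a}) (rR∀ {x'}) h
    rewrite setWorld-≡ idRen x' x | setWorld-freshN idRen x' x a h | renameN-id a = refl
  samePremissesR (rR> {k = k}) (rR> {k = k'}) h
    rewrite setNbhd-≡ idRen k' (nv k) = refl

  mutual
    invertL : ∀ n {χ Γ Γ₁ Δ mL mR ps e} → Rule (χ ∷ []) [] mL mR ps e → Deriv n Γ Δ → Γ ↭ χ ∷ Γ₁ →
              Derivs n Γ₁ Δ ps
    invertL (suc n) {χ} {Γ} {Γ₁} {Δ} {e = e} r (rule {Γ = Γ₀} {Δ₀} {ps = ps'} {e'} s p q mL mR fr prs) pχ
      with shape s
    ... | noPrincipal = invertL-past n r s p q mL mR fr prs pχ differs[]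
    ... | rightPrincipal _ = invertL-past n r s p q mL mR fr prs pχ differs[]
    ... | leftPrincipal {χ'} rm with χ' ≟L χ
    ...   | no ne = invertL-past n r s p q mL mR fr prs pχ (differs∷ (λ eq → ne (sym eq)))
    ...   | yes refl =
      raiseAll (n≤1+n n) (permuteAll (subst (Derivs n Γ₀ Δ₀) (sym (samePremissesL r s (All.lookup fr (inΓ (here refl)))))
                                            (renameDerivs-fixing (eigenSwap e' e) (fixes (λ m → inΓ
                                                (there m))) (fixes (λ m → ∈-++⁺ʳ Γ (inΔ m))) prs))
                                  (drop-∷ (↭-trans (↭-sym p) pχ)) (↭-sym q))
      where
        inΓ : ∀ {φ} → φ ∈ _ → φ ∈ Γ ++ Δ
        inΓ m = ∈-++⁺ˡ (∈-resp-↭ (↭-sym p) m)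
        inΔ : ∀ {φ} → φ ∈ _ → φ ∈ Δ
        inΔ m = ∈-resp-↭ (↭-sym q) m
        fixes : ∀ {Y} → Y ⊆ Γ ++ Δ → renameAll (eigenSwap e' e) Y ≡ Y
        fixes Y⊆ = eigenSwap-fixes e' e _ (anti-mono Y⊆ fr)

    invertL-past : ∀ n {χ Γ Γ₁ Δ mL mR ps e Γ₀ Δ₀ pL' pR' mL' mR' ps' e'} → Rule (χ ∷ []) [] mL mR ps e →
                   Rule pL' pR' mL' mR' ps' e' → Γ ↭ pL' ++ Γ₀ → Δ ↭ pR' ++ Δ₀ → All (_∈ Γ₀) mL' → All (_∈ Δ₀) mR' →
                   FreshEigen e' Γ Δ → Derivs n Γ₀ Δ₀ ps' → Γ ↭ χ ∷ Γ₁ → Differs χ pL' → Derivs (suc n) Γ₁ Δ ps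
    invertL-past n {χ} {Γ} {Γ₁} {Δ} {ps = ps} {pL' = pL'} {pR'} r s p q mL mR fr prs pχ ni
      with splitContext (↭-trans (↭-sym pχ) p) ni | shape r | refreshInstance (Γ ++ Δ ++ premissFormulas ps) s p q mL mR fr prs
    ... | Θ , p₀ , p₁ | leftPrincipal rmχ | _ , _ , s′ , fresh , prs′ = tabulateDerivs ps premiss
      where
        premiss : ∀ {pr} → pr ∈ ps → Deriv (suc n) (proj₁ pr ++ Γ₁) (proj₂ pr ++ Δ)
        premiss {aL , aR} j =
          rule s′ (↭-trans (++⁺ˡ aL p₁) (shifts aL pL')) (↭-trans (++⁺ˡ aR q) (shifts aR pR'))
               (All.zipWith (λ (m , nr) → ∈-++⁺ʳ aL (∈-drop m p₀ (≢-by isLeftPrincipal nr rmχ))) (mL , sideL-notPrincipal s))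
               (All.map (∈-++⁺ʳ aR) mR)
               (anti-mono (premissContext⊆ j (λ m → ∈-resp-↭ (↭-sym pχ) (there m)) id) fresh)
               (mapDerivs (λ {bL} {bR} d → permute (lookupDerivs (invertL n r (permute d (↭-trans
                   (++⁺ˡ bL p₀) (shift χ bL Θ)) ↭-refl) ↭-refl) j)
                                                   (shifts aL bL) (shifts aR bR)) prs′)

  mutual
    invertR : ∀ n {χ Γ Δ Δ₁ mL mR ps e} → Rule [] (χ ∷ []) mL mR ps e → Deriv n Γ Δ → Δ ↭ χ ∷ Δ₁ →
              Derivs n Γ Δ₁ ps
    invertR (suc n) {χ} {Γ} {Δ} {Δ₁} {e = e} r (rule {Γ = Γ₀} {Δ₀} {ps = ps'} {e'} s p q mL mR fr prs) pχ
      with shape s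
    ... | noPrincipal = invertR-past n r s p q mL mR fr prs pχ differs[]
    ... | leftPrincipal _ = invertR-past n r s p q mL mR fr prs pχ differs[]
    ... | rightPrincipal {χ'} rm with χ' ≟L χ
    ...   | no ne = invertR-past n r s p q mL mR fr prs pχ (differs∷ (λ eq → ne (sym eq)))
    ...   | yes refl =
      raiseAll (n≤1+n n) (permuteAll (subst (Derivs n Γ₀ Δ₀) (sym (samePremissesR r s (All.lookup fr (inΔ (here refl)))))
                                            (renameDerivs-fixing (eigenSwap e' e) (fixes (λ m → ∈-++⁺ˡ
                                                (inΓ m))) (fixes (λ m → inΔ (there m))) prs))
                                  (↭-sym p) (drop-∷ (↭-trans (↭-sym q) pχ)))
      where
        inΓ : ∀ {φ} → φ ∈ _ → φ ∈ Γ
        inΓ m = ∈-resp-↭ (↭-sym p) m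
        inΔ : ∀ {φ} → φ ∈ _ → φ ∈ Γ ++ Δ
        inΔ m = ∈-++⁺ʳ Γ (∈-resp-↭ (↭-sym q) m)
        fixes : ∀ {Y} → Y ⊆ Γ ++ Δ → renameAll (eigenSwap e' e) Y ≡ Y
        fixes Y⊆ = eigenSwap-fixes e' e _ (anti-mono Y⊆ fr)

    invertR-past : ∀ n {χ Γ Δ Δ₁ mL mR ps e Γ₀ Δ₀ pL' pR' mL' mR' ps' e'} → Rule [] (χ ∷ []) mL mR ps e →
                   Rule pL' pR' mL' mR' ps' e' → Γ ↭ pL' ++ Γ₀ → Δ ↭ pR' ++ Δ₀ → All (_∈ Γ₀) mL' → All (_∈ Δ₀) mR' →
                   FreshEigen e' Γ Δ → Derivs n Γ₀ Δ₀ ps' → Δ ↭ χ ∷ Δ₁ → Differs χ pR' → Derivs (suc n) Γ Δ₁ ps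
    invertR-past n {χ} {Γ} {Δ} {Δ₁} {ps = ps} {pL' = pL'} {pR'} r s p q mL mR fr prs pχ ni
      with splitContext (↭-trans (↭-sym pχ) q) ni | shape r | refreshInstance (Γ ++ Δ ++ premissFormulas ps) s p q mL mR fr prs
    ... | Θ , q₀ , q₁ | rightPrincipal rmχ | _ , _ , s′ , fresh , prs′ = tabulateDerivs ps premiss
      where
        premiss : ∀ {pr} → pr ∈ ps → Deriv (suc n) (proj₁ pr ++ Γ) (proj₂ pr ++ Δ₁)
        premiss {aL , aR} j =
          rule s′ (↭-trans (++⁺ˡ aL p) (shifts aL pL')) (↭-trans (++⁺ˡ aR q₁) (shifts aR pR'))
               (All.map (∈-++⁺ʳ aL) mL)
               (All.zipWith (λ (m , nr) → ∈-++⁺ʳ aR (∈-drop m q₀ (≢-by isRightPrincipal nr rmχ))) (mR , sideR-notPrincipal s))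
               (anti-mono (premissContext⊆ j id (λ m → ∈-resp-↭ (↭-sym pχ) (there m))) fresh)
               (mapDerivs (λ {bL} {bR} d → permute (lookupDerivs (invertR n r (permute d ↭-refl (↭-trans
                   (++⁺ˡ bR q₀) (shift χ bR Θ))) ↭-refl) j)
                                                   (shifts aL bL) (shifts aR bR)) prs′)

  invert : ∀ n {pL pR mL mR ps e Γ Δ Γ₁ Δ₁} → Rule pL pR mL mR ps e → Deriv n Γ Δ →
           Γ ↭ pL ++ Γ₁ → Δ ↭ pR ++ Δ₁ → Derivs n Γ₁ Δ₁ ps
  invert n {ps = ps} {Γ₁ = Γ₁} {Δ₁} r d p q with shape r
  ... | leftPrincipal _ = permuteAll (invertL n r d p) ↭-refl q
  ... | rightPrincipal _ = permuteAll (invertR n r d q) p ↭-refl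
  ... | noPrincipal = tabulateDerivs ps (λ {pr} _ → permute (weaken (proj₁ pr) (proj₂ pr) d)
                                                          (↭-trans (++⁺ʳ (proj₁ pr) p) (++-comm Γ₁ (proj₁ pr)))
                                                          (↭-trans (++⁺ʳ (proj₂ pr) q) (++-comm Δ₁ (proj₂ pr))))

  size : Formula → ℕ
  size (atom _) = 1
  size falsum = 1
  size (A ∧ᶠ B) = suc (size A + size B)
  size (A ∨ᶠ B) = suc (size A + size B)
  size (A ⊃ B) = suc (size A + size B)
  size (A > B) = suc (suc (suc (suc (size A + size B))))

  -- Chosen so that every principal reduction cuts on lighter formulas; in particular
  -- x : A > B  is heavier than  x ⊩[ a ] A ∣ B, which is heavier than  c ⊩∃ A  and  c ⊩∀ (A ⊃ B).
  weight : LFormula → ℕ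
  weight (x ∶ A) = size A
  weight (a ⊩∃ A) = suc (size A)
  weight (a ⊩∀ A) = suc (size A)
  weight (x ⊩[ a ] A ∣ B) = suc (suc (suc (size A + size B)))
  weight _ = 1

  size≥1 : ∀ A → 1 ≤ size A
  size≥1 (atom _) = s≤s z≤n
  size≥1 falsum = s≤s z≤n
  size≥1 (A ∧ᶠ B) = s≤s z≤n
  size≥1 (A ∨ᶠ B) = s≤s z≤n
  size≥1 (A ⊃ B) = s≤s z≤n
  size≥1 (A > B) = s≤s z≤n

  weight≥1 : ∀ φ → 1 ≤ weight φ
  weight≥1 (a ∈N x) = s≤s z≤n
  weight≥1 (x ∈ₗ a) = s≤s z≤n
  weight≥1 (a ⊆ₗ b) = s≤s z≤n
  weight≥1 (x ∶ A) = size≥1 A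
  weight≥1 (a ⊩∃ A) = s≤s z≤n
  weight≥1 (a ⊩∀ A) = s≤s z≤n
  weight≥1 (x ⊩[ a ] A ∣ B) = s≤s z≤n

  sum≤⇒left≤ : ∀ {f} a b → suc (a + b) ≤ suc f → a ≤ f
  sum≤⇒left≤ a b le = ≤-trans (m≤m+n a b) (≤-pred le)
  sum≤⇒right≤ : ∀ {f} a b → suc (a + b) ≤ suc f → b ≤ f
  sum≤⇒right≤ a b le = ≤-trans (m≤n+m b a) (≤-pred le)
  ∣-weight-∃ : ∀ {f} a b → suc (suc (suc (a + b))) ≤ suc f → suc a ≤ f
  ∣-weight-∃ a b le = ≤-trans (s≤s (m≤m+n a b)) (≤-trans (n≤1+n _) (≤-pred le))
  ∣-weight-∀ : ∀ {f} a b → suc (suc (suc (a + b))) ≤ suc f → suc (suc (a + b)) ≤ f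
  ∣-weight-∀ a b le = ≤-pred le
  >-weight-∃ : ∀ {f} a b → suc (suc (suc (suc (a + b)))) ≤ suc f → suc a ≤ f
  >-weight-∃ a b le = ≤-trans (s≤s (m≤m+n a b)) (≤-trans (n≤1+n _) (≤-trans (n≤1+n _) (≤-pred le)))
  >-weight-∣ : ∀ {f} a b → suc (suc (suc (suc (a + b)))) ≤ suc f → suc (suc (suc (a + b))) ≤ f
  >-weight-∣ a b le = ≤-pred le

  Der : List LFormula → List LFormula → Set
  Der Γ Δ = Σ ℕ λ k → Deriv k Γ Δ

  data RightPremisses (Γ Δ : List LFormula) : LFormula → Set where
    premR∧ : ∀ {x A B} → Der Γ (x ∶ A ∷ Δ) → Der Γ (x ∶ B ∷ Δ) → RightPremisses Γ Δ (x ∶ (A ∧ᶠ B))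
    premR∨ : ∀ {x A B} → Der Γ (x ∶ A ∷ x ∶ B ∷ Δ) → RightPremisses Γ Δ (x ∶ (A ∨ᶠ B))
    premR⊃ : ∀ {x A B} → Der (x ∶ A ∷ Γ) (x ∶ B ∷ Δ) → RightPremisses Γ Δ (x ∶ (A ⊃ B))
    premR∀ : ∀ {y a A} → FreshEigen (worldEigen y) Γ (a ⊩∀ A ∷ Δ) → Der (y ∈ₗ a ∷ Γ) (y ∶ A ∷ Δ) → RightPremisses Γ Δ (a ⊩∀ A)
    premR> : ∀ {x k A B} → FreshEigen (nbhdEigen k) Γ (x ∶ (A > B) ∷ Δ) →
          Der (nv k ∈N x ∷ nv k ⊩∃ A ∷ Γ) (x ⊩[ nv k ] A ∣ B ∷ Δ) → RightPremisses Γ Δ (x ∶ (A > B))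
    premR∃ : ∀ {y a A} → (y ∈ₗ a) ∈ Γ → Der Γ (y ∶ A ∷ Δ) → RightPremisses Γ Δ (a ⊩∃ A)
    premR∣ : ∀ {x a c A B} → (c ∈N x) ∈ Γ → (c ⊆ₗ a) ∈ Γ → Der Γ (c ⊩∃ A ∷ Δ) → Der Γ (c ⊩∀ (A ⊃ B) ∷ Δ) →
          RightPremisses Γ Δ (x ⊩[ a ] A ∣ B)

  RightPremisses⇒hasRightRule : ∀ {Γ Δ φ} → RightPremisses Γ Δ φ → hasRightRule φ ≡ true
  RightPremisses⇒hasRightRule (premR∧ _ _) = refl
  RightPremisses⇒hasRightRule (premR∨ _) = refl
  RightPremisses⇒hasRightRule (premR⊃ _) = refl
  RightPremisses⇒hasRightRule (premR∀ _ _) = refl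
  RightPremisses⇒hasRightRule (premR> _ _) = refl
  RightPremisses⇒hasRightRule (premR∃ _ _) = refl
  RightPremisses⇒hasRightRule (premR∣ _ _ _ _) = refl

  noRightPremisses : ∀ {Γ Δ φ} → hasRightRule φ ≡ false → RightPremisses Γ Δ φ → ⊥
  noRightPremisses h lp with trans (sym h) (RightPremisses⇒hasRightRule lp)
  ... | ()

  All-∈-drop : ∀ {φ : LFormula} {Δ₀ Θ} ms → All (_∈ Δ₀) ms → Δ₀ ↭ φ ∷ Θ → All (_∈ Θ) ms ⊎ (φ ∈ ms)
  All-∈-drop [] [] p = inj₁ []
  All-∈-drop {φ} (ψ ∷ ms) (m ∷ as) p with ψ ≟L φ
  ... | yes refl = inj₂ (here refl)
  ... | no ne with All-∈-drop ms as p
  ...   | inj₁ r = inj₁ (∈-drop m p ne ∷ r)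
  ...   | inj₂ i = inj₂ (there i)

  collectDerivs : ∀ {Γ Δ} ps → (∀ {p} → p ∈ ps → Der (proj₁ p ++ Γ) (proj₂ p ++ Δ)) → Σ ℕ λ k → Derivs k Γ Δ ps
  collectDerivs [] f = 0 , []
  collectDerivs (p ∷ ps) f with f (here refl) | collectDerivs ps (λ m → f (there m))
  ... | (k1 , d) | (k2 , ds) = (k1 ⊔ k2) , (raise (m≤m⊔n k1 k2) d ∷ raiseAll (m≤n⊔m k1 k2) ds)

  weakenL : ∀ {k Γ Δ} ψ → Deriv k Γ Δ → Deriv k (ψ ∷ Γ) Δ
  weakenL {Γ = Γ} ψ d = permute (weaken (ψ ∷ []) [] d) (++-comm Γ (ψ ∷ [])) (↭-reflexive (++-identityʳ _))

  weakenR : ∀ {k Γ Δ} ψ → Deriv k Γ Δ → Deriv k Γ (ψ ∷ Δ)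
  weakenR {Δ = Δ} ψ d = permute (weaken [] (ψ ∷ []) d) (↭-reflexive (++-identityʳ _)) (++-comm Δ (ψ ∷ []))

  CutBelow : ℕ → Set
  CutBelow f = ∀ {ψ X Y k₁ k₂} → weight ψ ≤ f → Deriv k₁ X (ψ ∷ Y) → Deriv k₂ (ψ ∷ X) Y → Der X Y

  rightPremisses : ∀ {n φ Γ Δ Γ₀ Δ₀ mL mR ps e} → Rule [] (φ ∷ []) mL mR ps e → Γ ↭ Γ₀ → Δ₀ ↭ Δ →
         FreshEigen e Γ (φ ∷ Δ) → Derivs n Γ₀ Δ₀ ps → RightPremisses Γ Δ φ
  rightPremisses rR∧ p q fr (d1 ∷ d2 ∷ []) = premR∧ (_ , permute d1 (↭-sym p) (prep _ q)) (_ , permute d2 (↭-sym p) (prep _ q))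
  rightPremisses rR∨ p q fr (d ∷ []) = premR∨ (_ , permute d (↭-sym p) (prep _ (prep _ q)))
  rightPremisses rR⊃ p q fr (d ∷ []) = premR⊃ (_ , permute d (prep _ (↭-sym p)) (prep _ q))
  rightPremisses rR∀ p q fr (d ∷ []) = premR∀ fr (_ , permute d (prep _ (↭-sym p)) (prep _ q))
  rightPremisses rR> p q fr (d ∷ []) = premR> fr (_ , permute d (prep _ (prep _ (↭-sym p))) (prep _ q))

  data RightSideCase (Γ Δ : List LFormula) (φ : LFormula) : Set where
    alreadyLeft : φ ∈ Γ → isLeftPrincipal φ ≡ false → RightSideCase Γ Δ φ
    viaRightRule : RightPremisses Γ Δ φ → RightSideCase Γ Δ φ

  -- A cut formula that is a kept right side formula of init, R∃ or R∣ either already occurs on the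
  -- left, or the rule itself, once φ is cut from its premisses, supplies right premisses for φ.
  rightSideCase : ∀ {n m φ Γ Δ Γ₀ Δ₀ Θ pL pR mL mR ps} → RightSideRule pL pR mL mR ps →
             (ih : ∀ {X Y} → Deriv n X (φ ∷ Y) → Deriv m (φ ∷ X) Y → Der X Y) →
             Γ ↭ pL ++ Γ₀ → Δ₀ ↭ φ ∷ Θ → Δ ↭ pR ++ Θ → All (_∈ Γ₀) mL → Derivs n Γ₀ Δ₀ ps → φ ∈ mR →
             Deriv m (φ ∷ Γ) Δ → RightSideCase Γ Δ φ
  rightSideCase sideInit ih p q₀ q₁ (m ∷ []) [] (here refl) d₂ = alreadyLeft (∈-resp-↭ (↭-sym p) m) refl
  rightSideCase (sideR∃ {x} {A = A}) ih p q₀ q₁ (m ∷ []) (d ∷ []) (here refl) d₂ =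
    viaRightRule (premR∃ (∈-resp-↭ (↭-sym p) m) (ih (permute d (↭-sym p) (↭-trans (prep _ q₀) (↭-trans
        (swap _ _ ↭-refl) (prep _ (prep _ (↭-sym q₁))))))
                                    (weakenR (x ∶ A) d₂)))
  rightSideCase sideR∣ ih p q₀ q₁ (m1 ∷ m2 ∷ []) (d1 ∷ d2 ∷ []) (here refl) d₂ =
    viaRightRule (premR∣ (∈-resp-↭ (↭-sym p) m1) (∈-resp-↭ (↭-sym p) m2)
           (ih (permute d1 (↭-sym p) (↭-trans (prep _ q₀) (↭-trans (swap _ _ ↭-refl) (prep _ (prep _ (↭-sym q₁)))))) (weakenR _ d₂))
           (ih (permute d2 (↭-sym p) (↭-trans (prep _ q₀) (↭-trans (swap _ _ ↭-refl) (prep _ (prep _ (↭-sym q₁)))))) (weakenR _ d₂)))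

  cong₃ : ∀ {A B C D : Set} (f : A → B → C → D) {a a' b b' c c'} → a ≡ a' → b ≡ b' → c ≡ c' → f a b c ≡ f a' b' c'
  cong₃ f refl refl refl = refl

  principalReduction : ∀ {f m φ Γ Δ Γ₀ Δ₀ mL mR ps e} → weight φ ≤ suc f → CutBelow f →
              Rule (φ ∷ []) [] mL mR ps e → Γ₀ ↭ Γ → Δ₀ ↭ Δ → FreshEigen e (φ ∷ Γ) Δ → Derivs m Γ₀ Δ₀ ps →
              RightPremisses Γ Δ φ → Der Γ Δ
  principalReduction {φ = x ∶ (A ∧ᶠ B)} le ih rL∧ p q fr (d ∷ []) (premR∧ (_ , dA) (_ , dB)) =
    ih (sum≤⇒left≤ (size A) (size B) le) dA
       (proj₂ (ih (sum≤⇒right≤ (size A) (size B) le) (weakenL (x ∶ A) dB) (permute d (↭-trans (prep _ (prep _ p)) (swap _ _ ↭-refl)) q)))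
  principalReduction {φ = x ∶ (A ∨ᶠ B)} le ih rL∨ p q fr (dA ∷ dB ∷ []) (premR∨ (_ , d)) =
    ih (sum≤⇒right≤ (size A) (size B) le)
       (proj₂ (ih (sum≤⇒left≤ (size A) (size B) le) d (weakenR (x ∶ B) (permute dA (prep _ p) q))))
       (permute dB (prep _ p) q)
  principalReduction {φ = x ∶ (A ⊃ B)} le ih rL⊃ p q fr (d1 ∷ d2 ∷ []) (premR⊃ (_ , d)) =
    ih (sum≤⇒left≤ (size A) (size B) le) (permute d1 p (prep _ q))
       (proj₂ (ih (sum≤⇒right≤ (size A) (size B) le) d (permute (weakenL (x ∶ A) d2) (↭-trans (prep _ (prep _ p)) (swap _ _ ↭-refl)) q)))
  principalReduction {m = m} {φ = a ⊩∃ A} {Γ} {Δ} {Γ₀} {Δ₀} le ih (rL∃ {z}) p q fr (dz ∷ []) (premR∃ {y} ya (_ , d)) =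
    ih (≤-pred le) d (contractL m (permute d' (prep _ (prep _ p)) q) (there ya) refl)
    where
      d' : Deriv m (y ∈ₗ a ∷ y ∶ A ∷ Γ₀) Δ₀
      d' = castDeriv (renameDeriv (setWorld idRen z y) dz)
             (cong₃ (λ u v w → u ∈ₗ v ∷ u ∶ A ∷ w) (setWorld-≡ idRen z y)
                    (trans (setWorld-freshN idRen z y a (All.head fr)) (renameN-id a))
                    (setWorld-fixes z y (anti-mono (λ m → there (∈-++⁺ˡ (∈-resp-↭ p m))) fr)))
             (setWorld-fixes z y (anti-mono (λ m → there (∈-++⁺ʳ Γ (∈-resp-↭ q m))) fr))
  principalReduction {m = m} {φ = x ⊩[ a ] A ∣ B} {Γ} {Δ} {Γ₀} {Δ₀} le ih (rL∣ {k = k}) p q fr (dk ∷ [])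
      (premR∣ {c = c} cN cA (_ , e1) (_ , e2)) =
    ih (∣-weight-∃ (size A) (size B) le) e1
       (proj₂ (ih (∣-weight-∀ (size A) (size B) le) (weakenL (c ⊩∃ A) e2) (permute d3 (swap _ _ ↭-refl) ↭-refl)))
    where
      d' : Deriv m (c ∈N x ∷ c ⊆ₗ a ∷ c ⊩∃ A ∷ c ⊩∀ (A ⊃ B) ∷ Γ₀) Δ₀
      d' = castDeriv (renameDeriv (setNbhd idRen k c) dk)
             (cong₃ (λ u v w → u ∈N x ∷ u ⊆ₗ v ∷ u ⊩∃ A ∷ u ⊩∀ (A ⊃ B) ∷ w) (setNbhd-≡ idRen k c)
                    (trans (setNbhd-freshN idRen k c a (All.head fr)) (renameN-id a))
                    (setNbhd-fixes k c (anti-mono (λ m → there (∈-++⁺ˡ (∈-resp-↭ p m))) fr)))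
             (setNbhd-fixes k c (anti-mono (λ m → there (∈-++⁺ʳ Γ (∈-resp-↭ q m))) fr))
      d2 : Deriv m (c ⊆ₗ a ∷ c ⊩∃ A ∷ c ⊩∀ (A ⊃ B) ∷ Γ) Δ
      d2 = contractL m (permute d' (prep _ (prep _ (prep _ (prep _ p)))) q) (there (there (there cN))) refl
      d3 : Deriv m (c ⊩∃ A ∷ c ⊩∀ (A ⊃ B) ∷ Γ) Δ
      d3 = contractL m d2 (there (there cA)) refl

  -- Dually, a cut formula used as a side formula by L∀ or L> on the left: cut it from the premisses,
  -- then reduce the remaining cuts on its subformulas.
  leftSideReduction : ∀ {f n m φ Γ Δ Γ₀ Δ₀ pL pR mL mR ps} → weight φ ≤ suc f → CutBelow f →
              (ihφ : ∀ {X Y} → Deriv n X (φ ∷ Y) → Deriv m (φ ∷ X) Y → Der X Y) → Deriv n Γ (φ ∷ Δ) →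
              LeftSideRule pL pR mL mR ps → φ ∷ Γ ↭ pL ++ Γ₀ → Δ ↭ pR ++ Δ₀ → All (_∈ Γ₀) mL → Derivs m Γ₀ Δ₀ ps →
              φ ∈ mL → RightPremisses Γ Δ φ → Der Γ Δ
  leftSideReduction le ih ihφ d₁ sideL∀ p q mL' prs (here refl) lp = ⊥-elim (noRightPremisses refl lp)
  leftSideReduction {φ = a ⊩∀ A} {Γ} {Δ} {Γ₀} le ih ihφ d₁ (sideL∀ {y}) p q (ya ∷ _ ∷ []) (dR ∷ []) (there
      (here refl)) (premR∀ {z} fz (k , dz)) =
    ih (≤-pred le) (contractL k d' ya' refl)
       (proj₂ (ihφ (weakenL (y ∶ A) d₁) (permute dR (↭-trans (prep _ (↭-sym p)) (swap _ _ ↭-refl)) (↭-sym q))))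
    where
      ya' : (y ∈ₗ a) ∈ Γ
      ya' = ∈-drop ya (↭-sym p) (λ ())
      d' : Deriv k (y ∈ₗ a ∷ Γ) (y ∶ A ∷ Δ)
      d' = castDeriv (renameDeriv (setWorld idRen z y) dz)
             (cong₃ (λ u v w → u ∈ₗ v ∷ w) (setWorld-≡ idRen z y)
                    (trans (setWorld-freshN idRen z y a (All.lookup fz (∈-++⁺ʳ Γ (here refl)))) (renameN-id a))
                    (setWorld-fixes z y (anti-mono ∈-++⁺ˡ fz)))
             (cong₂ (λ u w → u ∶ A ∷ w) (setWorld-≡ idRen z y) (setWorld-fixes z y (anti-mono (λ m → ∈-++⁺ʳ Γ (there m)) fz)))
  leftSideReduction le ih ihφ d₁ sideL> p q mL' prs (here refl) lp = ⊥-elim (noRightPremisses refl lp)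
  leftSideReduction {φ = x ∶ (A > B)} {Γ} {Δ} {Γ₀} le ih ihφ d₁ (sideL> {a = a}) p q (aN ∷ _ ∷ [])
      (d1 ∷ d2 ∷ []) (there (here refl)) (premR> {k = k} fk (k' , dk)) =
    ih (>-weight-∣ (size A) (size B) le) (proj₂ r) (proj₂ E2)
    where
      E1 : Der Γ (a ⊩∃ A ∷ Δ)
      E1 = ihφ (permute (weakenR (a ⊩∃ A) d₁) ↭-refl (swap _ _ ↭-refl)) (permute d1 (↭-sym p) (prep _ (↭-sym q)))
      E2 : Der (x ⊩[ a ] A ∣ B ∷ Γ) Δ
      E2 = ihφ (weakenL (x ⊩[ a ] A ∣ B) d₁) (permute d2 (↭-trans (prep _ (↭-sym p)) (swap _ _ ↭-refl)) (↭-sym q))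
      d' : Deriv k' (a ∈N x ∷ a ⊩∃ A ∷ Γ) (x ⊩[ a ] A ∣ B ∷ Δ)
      d' = castDeriv (renameDeriv (setNbhd idRen k a) dk)
             (cong₂ (λ u w → u ∈N x ∷ u ⊩∃ A ∷ w) (setNbhd-≡ idRen k a) (setNbhd-fixes k a (anti-mono ∈-++⁺ˡ fk)))
             (cong₂ (λ u w → x ⊩[ u ] A ∣ B ∷ w) (setNbhd-≡ idRen k a) (setNbhd-fixes k a (anti-mono (λ m → ∈-++⁺ʳ Γ (there m)) fk)))
      aN' : (a ∈N x) ∈ Γ
      aN' = ∈-drop aN (↭-sym p) (λ ())
      d3 : Deriv k' (a ⊩∃ A ∷ Γ) (x ⊩[ a ] A ∣ B ∷ Δ)
      d3 = contractL k' d' (there aN') refl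
      r : Der Γ (x ⊩[ a ] A ∣ B ∷ Δ)
      r = ih (>-weight-∃ (size A) (size B) le) (permute (weakenR (x ⊩[ a ] A ∣ B) (proj₂ E1)) ↭-refl (swap _ _ ↭-refl)) d3

  weight≢0 : ∀ {φ} → weight φ ≤ 0 → ⊥
  weight≢0 {φ} le with ≤-trans (weight≥1 φ) le
  ... | ()

  -- The recursion descends in the heights n, m while the weight bound F stays fixed, and lowers F
  -- (through CutBelow) in the principal reductions.
  mutual
    cut : ∀ F n m {φ Γ Δ} → weight φ ≤ F → Deriv n Γ (φ ∷ Δ) → Deriv m (φ ∷ Γ) Δ → Der Γ Δ
    cut F (suc n) m {φ} {Γ} {Δ} le (rule s p q mL' mR' fr prs) d₂ with shape s
    ... | noPrincipal = cut-permuteLeft F n m le s p q mL' mR' fr prs d₂ differs[]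
    ... | leftPrincipal _ = cut-permuteLeft F n m le s p q mL' mR' fr prs d₂ differs[]
    ... | rightPrincipal {χ} rm with χ ≟L φ
    ...   | yes refl = cut-rightPrincipal F (suc n) m le (rule s p q mL' mR' fr prs) (rightPremisses s p (drop-∷ (↭-sym q)) fr prs) d₂
    ...   | no ne = cut-permuteLeft F n m le s p q mL' mR' fr prs d₂ (differs∷ (λ eq → ne (sym eq)))

    cut-permuteLeft : ∀ F n m {φ Γ Δ Γ₀ Δ₀ pL pR mL mR ps e} → weight φ ≤ F → Rule pL pR mL mR ps e →
           Γ ↭ pL ++ Γ₀ → φ ∷ Δ ↭ pR ++ Δ₀ → All (_∈ Γ₀) mL → All (_∈ Δ₀) mR → FreshEigen e Γ (φ ∷ Δ) →
           Derivs n Γ₀ Δ₀ ps → Deriv m (φ ∷ Γ) Δ → Differs φ pR → Der Γ Δ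
    cut-permuteLeft F n m {φ} {Γ} {Δ} {Γ₀} {Δ₀} {pL} {pR} {mL} {mR} {ps} le s p q mL' mR' fr prs d₂ ni with splitContext q ni
    ... | Θ , q₀ , q₁ with All-∈-drop mR mR' q₀
    ...   | inj₁ mRΘ with collectDerivs ps f
      where
        inv : Derivs m (φ ∷ Γ₀) Θ ps
        inv = invert m s d₂ (↭-trans (prep φ p) (↭-sym (shift φ pL Γ₀))) q₁
        f : ∀ {pr} → pr ∈ ps → Der (proj₁ pr ++ Γ₀) (proj₂ pr ++ Θ)
        f {aL , aR} j = cut F n m le (permute (lookupDerivs prs j) ↭-refl (↭-trans (++⁺ˡ aR q₀) (shift φ aR Θ)))
                                    (permute (lookupDerivs inv j) (shift φ aL Γ₀) ↭-refl)
    ...     | k , ps'' = suc k , rule s p q₁ mL' mRΘ (All-drop Γ fr) ps''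
    cut-permuteLeft F n m {φ} {Γ} {Δ} {Γ₀} {Δ₀} {pL} {pR} {mL} {mR} {ps} le s p q mL' mR' fr prs d₂ ni
        | Θ , q₀ , q₁ | inj₂ mem with rightSide-classify s
    ...     | inj₁ refl = case mem of λ ()
    ...     | inj₂ kr with rightSideCase kr (λ a b → cut F n m le a b) p q₀ q₁ mL' prs mem d₂
    ...       | alreadyLeft φΓ nr = m , contractL m d₂ φΓ nr
    ...       | viaRightRule lp = cut-rightPrincipal F (suc n) m le (rule s p q mL' mR' fr prs) lp d₂

    cut-rightPrincipal : ∀ F n m {φ Γ Δ} → weight φ ≤ F → Deriv n Γ (φ ∷ Δ) → RightPremisses Γ Δ φ → Deriv m (φ ∷ Γ) Δ → Der Γ Δ
    cut-rightPrincipal F n (suc m) {φ} {Γ} {Δ} le d₁ lp (rule t p q mL' mR' fr prs) with shape t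
    ... | noPrincipal = cut-permuteRight F n m le d₁ lp t p q mL' mR' fr prs differs[]
    ... | rightPrincipal _ = cut-permuteRight F n m le d₁ lp t p q mL' mR' fr prs differs[]
    ... | leftPrincipal {χ} rm with χ ≟L φ
    ...   | yes refl = cut-principal F le t (↭-sym (drop-∷ p)) (↭-sym q) fr prs lp
    ...   | no ne = cut-permuteRight F n m le d₁ lp t p q mL' mR' fr prs (differs∷ (λ eq → ne (sym eq)))

    cut-principal : ∀ F {m φ Γ Δ Γ₀ Δ₀ mL mR ps e} → weight φ ≤ F →
              Rule (φ ∷ []) [] mL mR ps e → Γ₀ ↭ Γ → Δ₀ ↭ Δ → FreshEigen e (φ ∷ Γ) Δ → Derivs m Γ₀ Δ₀ ps →
              RightPremisses Γ Δ φ → Der Γ Δ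
    cut-principal zero {φ = φ} le t p q fr prs lp = ⊥-elim (weight≢0 {φ} le)
    cut-principal (suc f) le t p q fr prs lp = principalReduction le (λ le' a b → cut f _ _ le' a b) t p q fr prs lp

    cut-leftSide : ∀ F {n m φ Γ Δ Γ₀ Δ₀ pL pR mL mR ps} → weight φ ≤ F →
              (ihφ : ∀ {X Y} → Deriv n X (φ ∷ Y) → Deriv m (φ ∷ X) Y → Der X Y) → Deriv n Γ (φ ∷ Δ) →
              LeftSideRule pL pR mL mR ps → φ ∷ Γ ↭ pL ++ Γ₀ → Δ ↭ pR ++ Δ₀ → All (_∈ Γ₀) mL → Derivs m Γ₀ Δ₀ ps →
              φ ∈ mL → RightPremisses Γ Δ φ → Der Γ Δ
    cut-leftSide zero {φ = φ} le ihφ d₁ kl p q mL' prs mem lp = ⊥-elim (weight≢0 {φ} le)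
    cut-leftSide (suc f) le ihφ d₁ kl p q mL' prs mem lp = leftSideReduction le (λ le' a b → cut f _ _ le' a b) ihφ d₁ kl p q mL' prs mem lp

    cut-permuteRight : ∀ F n m {φ Γ Δ Γ₀ Δ₀ pL pR mL mR ps e} → weight φ ≤ F → Deriv n Γ (φ ∷ Δ) → RightPremisses Γ Δ φ →
            Rule pL pR mL mR ps e → φ ∷ Γ ↭ pL ++ Γ₀ → Δ ↭ pR ++ Δ₀ → All (_∈ Γ₀) mL → All (_∈ Δ₀) mR →
            FreshEigen e (φ ∷ Γ) Δ → Derivs m Γ₀ Δ₀ ps → Differs φ pL → Der Γ Δ
    cut-permuteRight F n m {φ} {Γ} {Δ} {Γ₀} {Δ₀} {pL} {pR} {mL} {mR} {ps} le d₁ lp t p q mL' mR' fr prs ni with splitContext p ni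
    ... | Θ , p₀ , p₁ with All-∈-drop mL mL' p₀
    ...   | inj₁ mLΘ with collectDerivs ps g
      where
        inv : Derivs n Θ (φ ∷ Δ₀) ps
        inv = invert n t d₁ p₁ (↭-trans (prep φ q) (↭-sym (shift φ pR Δ₀)))
        g : ∀ {pr} → pr ∈ ps → Der (proj₁ pr ++ Θ) (proj₂ pr ++ Δ₀)
        g {aL , aR} j = cut F n m le (permute (lookupDerivs inv j) ↭-refl (shift φ aR Δ₀))
                                          (permute (lookupDerivs prs j) (↭-trans (++⁺ˡ aL p₀) (shift φ aL Θ)) ↭-refl)
    ...     | k , ps'' = suc k , rule t p₁ q mLΘ mR' (All.tail fr) ps''
    cut-permuteRight F n m {φ} {Γ} {Δ} {Γ₀} {Δ₀} {pL} {pR} {mL} {mR} {ps} le d₁ lp t p q mL' mR' fr prs ni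
        | Θ , p₀ , p₁ | inj₂ mem with leftSide-classify t
    ...     | inj₁ nol = ⊥-elim (noRightPremisses (All.lookup nol mem) lp)
    ...     | inj₂ kl = cut-leftSide F le (λ a b → cut F n m le a b) d₁ kl p q mL' prs mem lp

  pattern #0 = here refl
  pattern #1 = there #0
  pattern #2 = there #1
  pattern #3 = there #2
  pattern #4 = there #3
  pattern #5 = there #4
  pattern #6 = there #5
  pattern #7 = there #6
  pattern #8 = there #7
  pattern #9 = there #8
  pattern #10 = there #9
  pattern #11 = there #10
  pattern #12 = there #11

  infixl 5 _─_
  _─_ : ∀ {φ : LFormula} (Γ : List LFormula) → φ ∈ Γ → List LFormula
  (x ∷ Γ) ─ here _ = Γ
  (x ∷ Γ) ─ there m = x ∷ (Γ ─ m)

  ↭-remove : ∀ {φ : LFormula} {Γ} (m : φ ∈ Γ) → Γ ↭ φ ∷ (Γ ─ m)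
  ↭-remove #0 = ↭-refl
  ↭-remove {Γ = x ∷ Γ} (there m) = ↭-trans (prep x (↭-remove m)) (swap x _ ↭-refl)

  freshWorld : ∀ Γ Δ → FreshEigen (worldEigen (suc (maxWorlds (Γ ++ Δ)))) Γ Δ
  freshWorld Γ Δ = >max⇒freshW (Γ ++ Δ) _ ≤-refl

  freshNbhd : ∀ Γ Δ → FreshEigen (nbhdEigen (suc (maxNbhds (Γ ++ Δ)))) Γ Δ
  freshNbhd Γ Δ = >max⇒freshN (Γ ++ Δ) _ ≤-refl

  single : ∀ {Γ Δ aL aR} → Der (aL ++ Γ) (aR ++ Δ) → Σ ℕ λ k → Derivs k Γ Δ ((aL , aR) ∷ [])
  single (k , d) = k , d ∷ []

  pair : ∀ {Γ Δ aL aR bL bR} → Der (aL ++ Γ) (aR ++ Δ) → Der (bL ++ Γ) (bR ++ Δ) →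
        Σ ℕ λ k → Derivs k Γ Δ ((aL , aR) ∷ (bL , bR) ∷ [])
  pair (k1 , d1) (k2 , d2) = (k1 ⊔ k2) , raise (m≤m⊔n k1 k2) d1 ∷ raise (m≤n⊔m k1 k2) d2 ∷ []

  -- The derived rules below take the premiss of an eigenvariable rule for every label, and
  -- instantiate it with a label fresh for the conclusion.
  byRule : ∀ {Γ' Δ' Γ Δ pL pR mL mR ps e} → Rule pL pR mL mR ps e → Γ' ↭ pL ++ Γ → Δ' ↭ pR ++ Δ →
        All (_∈ Γ) mL → All (_∈ Δ) mR → FreshEigen e Γ' Δ' → Σ ℕ (λ k → Derivs k Γ Δ ps) → Der Γ' Δ'
  byRule r p q mL mR fr (k , ps) = suc k , rule r p q mL mR fr ps

  dPerm : ∀ {Γ Δ Γ' Δ'} → Der Γ Δ → Γ ↭ Γ' → Δ ↭ Δ' → Der Γ' Δ'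
  dPerm (k , d) p q = k , permute d p q

  dWk : ∀ {Γ Δ} Θ Λ → Der Γ Δ → Der (Γ ++ Θ) (Δ ++ Λ)
  dWk Θ Λ (k , d) = k , weaken Θ Λ d

  dRen : ∀ {Γ Δ} ρ → Der Γ Δ → Der (renameAll ρ Γ) (renameAll ρ Δ)
  dRen ρ (k , d) = k , renameDeriv ρ d

  dCut : ∀ {Γ Δ} φ → Der Γ (φ ∷ Δ) → Der (φ ∷ Γ) Δ → Der Γ Δ
  dCut φ (k1 , d1) (k2 , d2) = cut (weight φ) k1 k2 ≤-refl d1 d2

  dInit : ∀ {Γ Δ x p} → (x ∶ atom p) ∈ Γ → (x ∶ atom p) ∈ Δ → Der Γ Δ
  dInit {Γ} {Δ} m1 m2 = byRule rInit ↭-refl ↭-refl (m1 ∷ []) (m2 ∷ []) (noEigenFresh (Γ ++ Δ)) (0 , [])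

  dInit⊥ : ∀ {Γ Δ x} → (x ∶ falsum) ∈ Γ → Der Γ Δ
  dInit⊥ {Γ} {Δ} m = byRule rInit⊥ ↭-refl ↭-refl (m ∷ []) [] (noEigenFresh (Γ ++ Δ)) (0 , [])

  dL∧ : ∀ {Γ Δ x A B} (m : (x ∶ (A ∧ᶠ B)) ∈ Γ) → Der (x ∶ A ∷ x ∶ B ∷ (Γ ─ m)) Δ → Der Γ Δ
  dL∧ {Γ} {Δ} m d = byRule rL∧ (↭-remove m) ↭-refl [] [] (noEigenFresh (Γ ++ Δ)) (single d)

  dR∧ : ∀ {Γ Δ x A B} (m : (x ∶ (A ∧ᶠ B)) ∈ Δ) → Der Γ (x ∶ A ∷ (Δ ─ m)) → Der Γ (x ∶ B ∷ (Δ ─ m)) → Der Γ Δ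
  dR∧ {Γ} {Δ} m d1 d2 = byRule rR∧ ↭-refl (↭-remove m) [] [] (noEigenFresh (Γ ++ Δ)) (pair d1 d2)

  dL∨ : ∀ {Γ Δ x A B} (m : (x ∶ (A ∨ᶠ B)) ∈ Γ) → Der (x ∶ A ∷ (Γ ─ m)) Δ → Der (x ∶ B ∷ (Γ ─ m)) Δ → Der Γ Δ
  dL∨ {Γ} {Δ} m d1 d2 = byRule rL∨ (↭-remove m) ↭-refl [] [] (noEigenFresh (Γ ++ Δ)) (pair d1 d2)

  dR∨ : ∀ {Γ Δ x A B} (m : (x ∶ (A ∨ᶠ B)) ∈ Δ) → Der Γ (x ∶ A ∷ x ∶ B ∷ (Δ ─ m)) → Der Γ Δ
  dR∨ {Γ} {Δ} m d = byRule rR∨ ↭-refl (↭-remove m) [] [] (noEigenFresh (Γ ++ Δ)) (single d)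

  dL⊃ : ∀ {Γ Δ x A B} (m : (x ∶ (A ⊃ B)) ∈ Γ) → Der (Γ ─ m) (x ∶ A ∷ Δ) → Der (x ∶ B ∷ (Γ ─ m)) Δ → Der Γ Δ
  dL⊃ {Γ} {Δ} m d1 d2 = byRule rL⊃ (↭-remove m) ↭-refl [] [] (noEigenFresh (Γ ++ Δ)) (pair d1 d2)

  dR⊃ : ∀ {Γ Δ x A B} (m : (x ∶ (A ⊃ B)) ∈ Δ) → Der (x ∶ A ∷ Γ) (x ∶ B ∷ (Δ ─ m)) → Der Γ Δ
  dR⊃ {Γ} {Δ} m d = byRule rR⊃ ↭-refl (↭-remove m) [] [] (noEigenFresh (Γ ++ Δ)) (single d)

  dL∀ : ∀ {Γ Δ x a A} → (x ∈ₗ a) ∈ Γ → (a ⊩∀ A) ∈ Γ → Der (x ∶ A ∷ Γ) Δ → Der Γ Δ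
  dL∀ {Γ} {Δ} m1 m2 d = byRule rL∀ ↭-refl ↭-refl (m1 ∷ m2 ∷ []) [] (noEigenFresh (Γ ++ Δ)) (single d)

  dR∀ : ∀ {Γ Δ a A} (m : (a ⊩∀ A) ∈ Δ) → (∀ y → Der (y ∈ₗ a ∷ Γ) (y ∶ A ∷ (Δ ─ m))) → Der Γ Δ
  dR∀ {Γ} {Δ} m f = byRule rR∀ ↭-refl (↭-remove m) [] [] (freshWorld Γ Δ) (single (f _))

  dL∃ : ∀ {Γ Δ a A} (m : (a ⊩∃ A) ∈ Γ) → (∀ y → Der (y ∈ₗ a ∷ y ∶ A ∷ (Γ ─ m)) Δ) → Der Γ Δ
  dL∃ {Γ} {Δ} m f = byRule rL∃ (↭-remove m) ↭-refl [] [] (freshWorld Γ Δ) (single (f _))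

  dR∃ : ∀ {Γ Δ x a A} → (x ∈ₗ a) ∈ Γ → (a ⊩∃ A) ∈ Δ → Der Γ (x ∶ A ∷ Δ) → Der Γ Δ
  dR∃ {Γ} {Δ} m1 m2 d = byRule rR∃ ↭-refl ↭-refl (m1 ∷ []) (m2 ∷ []) (noEigenFresh (Γ ++ Δ)) (single d)

  dR> : ∀ {Γ Δ x A B} (m : (x ∶ (A > B)) ∈ Δ) →
        (∀ k → Der (nv k ∈N x ∷ nv k ⊩∃ A ∷ Γ) (x ⊩[ nv k ] A ∣ B ∷ (Δ ─ m))) → Der Γ Δ
  dR> {Γ} {Δ} m f = byRule rR> ↭-refl (↭-remove m) [] [] (freshNbhd Γ Δ) (single (f _))

  dL> : ∀ {Γ Δ x a A B} → (a ∈N x) ∈ Γ → (x ∶ (A > B)) ∈ Γ → Der Γ (a ⊩∃ A ∷ Δ) →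
        Der (x ⊩[ a ] A ∣ B ∷ Γ) Δ → Der Γ Δ
  dL> {Γ} {Δ} m1 m2 d1 d2 = byRule rL> ↭-refl ↭-refl (m1 ∷ m2 ∷ []) [] (noEigenFresh (Γ ++ Δ)) (pair d1 d2)

  dR∣ : ∀ {Γ Δ x a c A B} → (c ∈N x) ∈ Γ → (c ⊆ₗ a) ∈ Γ → (x ⊩[ a ] A ∣ B) ∈ Δ →
        Der Γ (c ⊩∃ A ∷ Δ) → Der Γ (c ⊩∀ (A ⊃ B) ∷ Δ) → Der Γ Δ
  dR∣ {Γ} {Δ} m1 m2 m3 d1 d2 = byRule rR∣ ↭-refl ↭-refl (m1 ∷ m2 ∷ []) (m3 ∷ []) (noEigenFresh (Γ ++ Δ)) (pair d1 d2)

  dL∣ : ∀ {Γ Δ x a A B} (m : (x ⊩[ a ] A ∣ B) ∈ Γ) →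
        (∀ k → Der (nv k ∈N x ∷ nv k ⊆ₗ a ∷ nv k ⊩∃ A ∷ nv k ⊩∀ (A ⊃ B) ∷ (Γ ─ m)) Δ) → Der Γ Δ
  dL∣ {Γ} {Δ} m f = byRule rL∣ (↭-remove m) ↭-refl [] [] (freshNbhd Γ Δ) (single (f _))

  dRef : ∀ {Γ Δ} a → Der (a ⊆ₗ a ∷ Γ) Δ → Der Γ Δ
  dRef {Γ} {Δ} a d = byRule (rRel rRef) ↭-refl ↭-refl [] [] (noEigenFresh (Γ ++ Δ)) (single d)

  dTr : ∀ {Γ Δ a b c} → (c ⊆ₗ b) ∈ Γ → (b ⊆ₗ a) ∈ Γ → Der (c ⊆ₗ a ∷ Γ) Δ → Der Γ Δ
  dTr {Γ} {Δ} m1 m2 d = byRule (rRel rTr) ↭-refl ↭-refl (m1 ∷ m2 ∷ []) [] (noEigenFresh (Γ ++ Δ)) (single d)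

  dL⊆ : ∀ {Γ Δ x a b} → (x ∈ₗ a) ∈ Γ → (a ⊆ₗ b) ∈ Γ → Der (x ∈ₗ b ∷ Γ) Δ → Der Γ Δ
  dL⊆ {Γ} {Δ} m1 m2 d = byRule (rRel rL⊆) ↭-refl ↭-refl (m1 ∷ m2 ∷ []) [] (noEigenFresh (Γ ++ Δ)) (single d)

  dN : ∀ {Γ Δ} → 1 ≤ rank (level L) → ∀ x → (∀ k → Der (nv k ∈N x ∷ Γ) Δ) → Der Γ Δ
  dN {Γ} {Δ} h x f = byRule (rRel (rN h)) ↭-refl ↭-refl [] [] (freshNbhd Γ Δ) (single (f _))

  d0 : ∀ {Γ Δ x a} → 1 ≤ rank (level L) → (a ∈N x) ∈ Γ → (∀ y → Der (y ∈ₗ a ∷ Γ) Δ) → Der Γ Δ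
  d0 {Γ} {Δ} h m f = byRule (rRel (r0 h)) ↭-refl ↭-refl (m ∷ []) [] (freshWorld Γ Δ) (single (f _))

  dT : ∀ {Γ Δ} → 2 ≤ rank (level L) → ∀ x → (∀ k → Der (x ∈ₗ nv k ∷ nv k ∈N x ∷ Γ) Δ) → Der Γ Δ
  dT {Γ} {Δ} h x f = byRule (rRel (rT h)) ↭-refl ↭-refl [] [] (freshNbhd Γ Δ) (single (f _))

  dW : ∀ {Γ Δ x a} → 3 ≤ rank (level L) → (a ∈N x) ∈ Γ → Der (x ∈ₗ a ∷ Γ) Δ → Der Γ Δ
  dW {Γ} {Δ} h m d = byRule (rRel (rW h)) ↭-refl ↭-refl (m ∷ []) [] (noEigenFresh (Γ ++ Δ)) (single d)

  dSingle : ∀ {Γ Δ x} → level L ≡ lC → (sng x ∈N x) ∈ Γ → Der (x ∈ₗ sng x ∷ Γ) Δ → Der Γ Δ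
  dSingle {Γ} {Δ} h m d = byRule (rRel (rSingle h)) ↭-refl ↭-refl (m ∷ []) [] (noEigenFresh (Γ ++ Δ)) (single d)

  dC : ∀ {Γ Δ x a} → level L ≡ lC → (a ∈N x) ∈ Γ → Der (sng x ∈N x ∷ sng x ⊆ₗ a ∷ Γ) Δ → Der Γ Δ
  dC {Γ} {Δ} h m d = byRule (rRel (rC h)) ↭-refl ↭-refl (m ∷ []) [] (noEigenFresh (Γ ++ Δ)) (single d)

  dRepl₁ : ∀ {Γ Δ x y} t → level L ≡ lC → (y ∈ₗ sng x) ∈ Γ → At t x ∈ Γ → Der (At t y ∷ Γ) Δ → Der Γ Δ
  dRepl₁ {Γ} {Δ} t h m1 m2 d = byRule (rRel (rRepl₁ t h)) ↭-refl ↭-refl (m1 ∷ m2 ∷ []) [] (noEigenFresh (Γ ++ Δ)) (single d)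

  dRepl₂ : ∀ {Γ Δ x y} t → level L ≡ lC → (y ∈ₗ sng x) ∈ Γ → At t y ∈ Γ → Der (At t x ∷ Γ) Δ → Der Γ Δ
  dRepl₂ {Γ} {Δ} t h m1 m2 d = byRule (rRel (rRepl₂ t h)) ↭-refl ↭-refl (m1 ∷ m2 ∷ []) [] (noEigenFresh (Γ ++ Δ)) (single d)

  dU₁ : ∀ {Γ Δ x y z a b} → suffix L ≡ sU → (a ∈N x) ∈ Γ → (y ∈ₗ a) ∈ Γ → (b ∈N y) ∈ Γ → (z ∈ₗ b) ∈ Γ →
        (∀ k → Der (z ∈ₗ nv k ∷ nv k ∈N x ∷ Γ) Δ) → Der Γ Δ
  dU₁ {Γ} {Δ} h m1 m2 m3 m4 f = byRule (rRel (rU₁ h)) ↭-refl ↭-refl (m1 ∷ m2 ∷ m3 ∷ m4 ∷ []) [] (freshNbhd Γ Δ) (single (f _))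

  dU₂ : ∀ {Γ Δ x y z a b} → suffix L ≡ sU → (a ∈N x) ∈ Γ → (y ∈ₗ a) ∈ Γ → (b ∈N x) ∈ Γ → (z ∈ₗ b) ∈ Γ →
        (∀ k → Der (z ∈ₗ nv k ∷ nv k ∈N y ∷ Γ) Δ) → Der Γ Δ
  dU₂ {Γ} {Δ} h m1 m2 m3 m4 f = byRule (rRel (rU₂ h)) ↭-refl ↭-refl (m1 ∷ m2 ∷ m3 ∷ m4 ∷ []) [] (freshNbhd Γ Δ) (single (f _))

  dA₁ : ∀ {Γ Δ x y a b} → suffix L ≡ sA → (a ∈N x) ∈ Γ → (y ∈ₗ a) ∈ Γ → (b ∈N x) ∈ Γ →
        Der (b ∈N y ∷ Γ) Δ → Der Γ Δ
  dA₁ {Γ} {Δ} h m1 m2 m3 d = byRule (rRel (rA₁ h)) ↭-refl ↭-refl (m1 ∷ m2 ∷ m3 ∷ []) [] (noEigenFresh (Γ ++ Δ)) (single d)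

  dA₂ : ∀ {Γ Δ x y a b} → suffix L ≡ sA → (a ∈N x) ∈ Γ → (y ∈ₗ a) ∈ Γ → (b ∈N y) ∈ Γ →
        Der (b ∈N x ∷ Γ) Δ → Der Γ Δ
  dA₂ {Γ} {Δ} h m1 m2 m3 d = byRule (rRel (rA₂ h)) ↭-refl ↭-refl (m1 ∷ m2 ∷ m3 ∷ []) [] (noEigenFresh (Γ ++ Δ)) (single d)

  mutual
    identity₀ : ∀ A → Der (0 ∶ A ∷ []) (0 ∶ A ∷ [])
    identity₀ (atom p) = dInit #0 #0
    identity₀ falsum = dInit⊥ #0
    identity₀ (A ∧ᶠ B) = dL∧ #0 (dR∧ #0 (identity A #0 #0) (identity B #1 #0))
    identity₀ (A ∨ᶠ B) = dR∨ #0 (dL∨ #0 (identity A #0 #0) (identity B #0 #1))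
    identity₀ (A ⊃ B) = identity⊃ A B #0 #0
    identity₀ (A > B) = dR> #0 (λ k → dL> #0 #2 (identity∃ A #1 #0)
                                             (identity∣ A B #0 #0))

    identity : ∀ A {x Γ Δ} → (x ∶ A) ∈ Γ → (x ∶ A) ∈ Δ → Der Γ Δ
    identity A {x} {Γ} {Δ} m1 m2 =
      dPerm (dWk (Γ ─ m1) (Δ ─ m2) (dRen (allWorldsTo x) (identity₀ A))) (↭-sym (↭-remove m1)) (↭-sym (↭-remove m2))

    identity⊃ : ∀ A B {x Γ Δ} → (x ∶ (A ⊃ B)) ∈ Γ → (x ∶ (A ⊃ B)) ∈ Δ → Der Γ Δ
    identity⊃ A B m1 m2 = dR⊃ m2 (dL⊃ (there m1) (identity A #0 #0) (identity B #0 #0))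

    identity∃ : ∀ A {a Γ Δ} → (a ⊩∃ A) ∈ Γ → (a ⊩∃ A) ∈ Δ → Der Γ Δ
    identity∃ A m1 m2 = dL∃ m1 (λ y → dR∃ #0 m2 (identity A #1 #0))

    identity∀⊃ : ∀ A B {a Γ Δ} → (a ⊩∀ (A ⊃ B)) ∈ Γ → (a ⊩∀ (A ⊃ B)) ∈ Δ → Der Γ Δ
    identity∀⊃ A B m1 m2 = dR∀ m2 (λ y → dL∀ #0 (there m1) (identity⊃ A B #0 #0))

    identity∣ : ∀ A B {x a Γ Δ} → (x ⊩[ a ] A ∣ B) ∈ Γ → (x ⊩[ a ] A ∣ B) ∈ Δ → Der Γ Δ
    identity∣ A B m1 m2 = dL∣ m1 (λ k → dR∣ #0 #1 m2
                                    (identity∃ A #2 #0)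
                                    (identity∀⊃ A B #3 #0))

  labelAll : ℕ → List Formula → List LFormula
  labelAll x = map (x ∶_)

  Valid : List Formula → List Formula → Set
  Valid Γ Δ = ∀ f → Any (λ A → eval f A ≡ false) Γ ⊎ Any (λ B → eval f B ≡ true) Δ

  data Atomic : Formula → Set where
    isAtom : ∀ p → Atomic (atom p)
    isFalsum : Atomic falsum
    isConditional : ∀ A B → Atomic (A > B)

  sizeAll : List Formula → ℕ
  sizeAll [] = 0
  sizeAll (A ∷ X) = size A + sizeAll X

  ∧-false : ∀ a b → a ∧ b ≡ false → a ≡ false ⊎ b ≡ false
  ∧-false false b e = inj₁ refl
  ∧-false true b e = inj₂ e
  ∧-true : ∀ a b → a ∧ b ≡ true → a ≡ true × b ≡ true
  ∧-true true true e = refl , refl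
  ∨-false : ∀ a b → a ∨ b ≡ false → a ≡ false × b ≡ false
  ∨-false false false e = refl , refl
  ∨-true : ∀ a b → a ∨ b ≡ true → a ≡ true ⊎ b ≡ true
  ∨-true true b e = inj₁ refl
  ∨-true false b e = inj₂ e
  ⇒-false : ∀ a b → a ⇒ᵇ b ≡ false → a ≡ true × b ≡ false
  ⇒-false true false e = refl , refl
  ⇒-true : ∀ a b → a ⇒ᵇ b ≡ true → a ≡ false ⊎ b ≡ true
  ⇒-true false b e = inj₁ refl
  ⇒-true true b e = inj₂ e

  fuel-L∧ : ∀ {n} a b t r → (suc (a + b) + t) + r ≤ suc n → (a + (b + t)) + r ≤ n
  fuel-L∧ {n} a b t r le = subst (λ u → u + r ≤ n) (+-assoc a b t) (≤-pred le)
  fuel-L-left : ∀ {n} a b t r → (suc (a + b) + t) + r ≤ suc n → (a + t) + r ≤ n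
  fuel-L-left a b t r le = ≤-trans (+-monoˡ-≤ r (+-monoˡ-≤ t (m≤m+n a b))) (≤-pred le)
  fuel-L-right : ∀ {n} a b t r → (suc (a + b) + t) + r ≤ suc n → (b + t) + r ≤ n
  fuel-L-right a b t r le = ≤-trans (+-monoˡ-≤ r (+-monoˡ-≤ t (m≤n+m b a))) (≤-pred le)
  fuel-L⊃₁ : ∀ {n} a b t r → (suc (a + b) + t) + r ≤ suc n → t + (a + r) ≤ n
  fuel-L⊃₁ {n} a b t r le = ≤-trans (≤-reflexive e) (fuel-L-left a b t r le)
    where
      e : t + (a + r) ≡ (a + t) + r
      e = trans (sym (+-assoc t a r)) (cong (_+ r) (+-comm t a))
  fuel-atomL : ∀ {n} x t r → 1 ≤ x → (x + t) + r ≤ suc n → t + r ≤ n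
  fuel-atomL {n} (suc x) t r (s≤s _) le = ≤-trans (+-monoˡ-≤ r (m≤n+m t x)) (≤-pred le)
  fuel-R-left : ∀ {n} a b r → suc (a + b) + r ≤ suc n → a + r ≤ n
  fuel-R-left a b r le = ≤-trans (+-monoˡ-≤ r (m≤m+n a b)) (≤-pred le)
  fuel-R-right : ∀ {n} a b r → suc (a + b) + r ≤ suc n → b + r ≤ n
  fuel-R-right a b r le = ≤-trans (+-monoˡ-≤ r (m≤n+m b a)) (≤-pred le)
  fuel-R∨ : ∀ {n} a b r → suc (a + b) + r ≤ suc n → a + (b + r) ≤ n
  fuel-R∨ {n} a b r le = subst (_≤ n) (+-assoc a b r) (≤-pred le)
  fuel-R⊃ : ∀ {n} a b r → suc (a + b) + r ≤ suc n → (a + 0) + (b + r) ≤ n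
  fuel-R⊃ {n} a b r le = subst (_≤ n) (trans (+-assoc a b r) (cong (_+ (b + r)) (sym (+-identityʳ a)))) (≤-pred le)

  atomicSequent : ∀ AL AR → All Atomic AL → All Atomic AR → Valid AL AR → Der (labelAll 0 AL) (labelAll 0 AR)
  atomicSequent AL AR atL atR v with falsum ∈? AL
  ... | yes fm = dInit⊥ (∈-map⁺ (0 ∶_) fm)
  ... | no nf with any? (_∈? AR) AL
  ...   | yes c with find c
  ...     | A , m1 , m2 = identity A (∈-map⁺ (0 ∶_) m1) (∈-map⁺ (0 ∶_) m2)
  atomicSequent AL AR atL atR v | no nf | no nc = ⊥-elim (contra (v f))
    where
      f : Formula → Bool
      f Y with Y ∈? AL
      ... | yes _ = true
      ... | no _ = false
      fin : ∀ {Y} → Y ∈ AL → f Y ≡ true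
      fin {Y} m with Y ∈? AL
      ... | yes _ = refl
      ... | no n = ⊥-elim (n m)
      fout : ∀ {Y} → f Y ≡ true → Y ∈ AL
      fout {Y} e with Y ∈? AL
      ... | yes m = m
      fout {Y} () | no _
      lefts : ∀ {X} → All Atomic X → (∀ {Y} → Y ∈ X → Y ∈ AL) → ¬ Any (λ A → eval f A ≡ false) X
      lefts (isAtom p ∷ _) sub (here e) with trans (sym (fin (sub #0))) e
      ... | ()
      lefts (isFalsum ∷ _) sub (here e) = nf (sub #0)
      lefts (isConditional A B ∷ _) sub (here e) with trans (sym (fin (sub #0))) e
      ... | ()
      lefts (_ ∷ as) sub (there a) = lefts as (λ m → sub (there m)) a
      rights : ∀ {X} → All Atomic X → (∀ {Y} → Y ∈ X → Y ∈ AR) → ¬ Any (λ B → eval f B ≡ true) X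
      rights (isAtom p ∷ _) sub (here e) = nc (Any.map (λ { refl → sub #0 }) (fout e))
      rights (isFalsum ∷ _) sub (here ())
      rights (isConditional A B ∷ _) sub (here e) = nc (Any.map (λ { refl → sub #0 }) (fout e))
      rights (_ ∷ as) sub (there a) = rights as (λ m → sub (there m)) a
      contra : ¬ (Any (λ A → eval f A ≡ false) AL ⊎ Any (λ B → eval f B ≡ true) AR)
      contra (inj₁ a) = lefts atL (λ m → m) a
      contra (inj₂ a) = rights atR (λ m → m) a

  fuel-atomR : ∀ {n} x r → 1 ≤ x → x + r ≤ suc n → r ≤ n
  fuel-atomR (suc x) r (s≤s _) le = ≤-trans (m≤n+m r x) (≤-pred le)

  noFuel : ∀ A x → size A + x ≤ 0 → ⊥
  noFuel A x le with ≤-trans (≤-trans (size≥1 A) (m≤m+n (size A) x)) le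
  ... | ()

  labelAll-shift : ∀ X TL AL → labelAll 0 (TL ++ X ∷ AL) ↭ (0 ∶ X) ∷ labelAll 0 (TL ++ AL)
  labelAll-shift X TL AL = map⁺ (0 ∶_) (shift X TL AL)

  vL∧ : ∀ {A B Γ Δ} → Valid ((A ∧ᶠ B) ∷ Γ) Δ → Valid (A ∷ B ∷ Γ) Δ
  vL∧ {A} {B} v f with v f
  ... | inj₂ a = inj₂ a
  ... | inj₁ (there a) = inj₁ (there (there a))
  ... | inj₁ (here e) with ∧-false (eval f A) (eval f B) e
  ...   | inj₁ e' = inj₁ (here e')
  ...   | inj₂ e' = inj₁ (there (here e'))

  vL∨₁ : ∀ {A B Γ Δ} → Valid ((A ∨ᶠ B) ∷ Γ) Δ → Valid (A ∷ Γ) Δ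
  vL∨₁ {A} {B} v f with v f
  ... | inj₂ a = inj₂ a
  ... | inj₁ (there a) = inj₁ (there a)
  ... | inj₁ (here e) = inj₁ (here (proj₁ (∨-false (eval f A) (eval f B) e)))

  vL∨₂ : ∀ {A B Γ Δ} → Valid ((A ∨ᶠ B) ∷ Γ) Δ → Valid (B ∷ Γ) Δ
  vL∨₂ {A} {B} v f with v f
  ... | inj₂ a = inj₂ a
  ... | inj₁ (there a) = inj₁ (there a)
  ... | inj₁ (here e) = inj₁ (here (proj₂ (∨-false (eval f A) (eval f B) e)))

  vL⊃₁ : ∀ {A B Γ Δ} → Valid ((A ⊃ B) ∷ Γ) Δ → Valid Γ (A ∷ Δ)
  vL⊃₁ {A} {B} v f with v f
  ... | inj₂ a = inj₂ (there a)
  ... | inj₁ (there a) = inj₁ a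
  ... | inj₁ (here e) = inj₂ (here (proj₁ (⇒-false (eval f A) (eval f B) e)))

  vL⊃₂ : ∀ {A B Γ Δ} → Valid ((A ⊃ B) ∷ Γ) Δ → Valid (B ∷ Γ) Δ
  vL⊃₂ {A} {B} v f with v f
  ... | inj₂ a = inj₂ a
  ... | inj₁ (there a) = inj₁ (there a)
  ... | inj₁ (here e) = inj₁ (here (proj₂ (⇒-false (eval f A) (eval f B) e)))

  vR∧₁ : ∀ {A B Γ Δ} → Valid Γ ((A ∧ᶠ B) ∷ Δ) → Valid Γ (A ∷ Δ)
  vR∧₁ {A} {B} v f with v f
  ... | inj₁ a = inj₁ a
  ... | inj₂ (there a) = inj₂ (there a)
  ... | inj₂ (here e) = inj₂ (here (proj₁ (∧-true (eval f A) (eval f B) e)))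

  vR∧₂ : ∀ {A B Γ Δ} → Valid Γ ((A ∧ᶠ B) ∷ Δ) → Valid Γ (B ∷ Δ)
  vR∧₂ {A} {B} v f with v f
  ... | inj₁ a = inj₁ a
  ... | inj₂ (there a) = inj₂ (there a)
  ... | inj₂ (here e) = inj₂ (here (proj₂ (∧-true (eval f A) (eval f B) e)))

  vR∨ : ∀ {A B Γ Δ} → Valid Γ ((A ∨ᶠ B) ∷ Δ) → Valid Γ (A ∷ B ∷ Δ)
  vR∨ {A} {B} v f with v f
  ... | inj₁ a = inj₁ a
  ... | inj₂ (there a) = inj₂ (there (there a))
  ... | inj₂ (here e) with ∨-true (eval f A) (eval f B) e
  ...   | inj₁ e' = inj₂ (here e')
  ...   | inj₂ e' = inj₂ (there (here e'))

  vR⊃ : ∀ {A B Γ Δ} → Valid Γ ((A ⊃ B) ∷ Δ) → Valid (A ∷ Γ) (B ∷ Δ)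
  vR⊃ {A} {B} v f with v f
  ... | inj₁ a = inj₁ (there a)
  ... | inj₂ (there a) = inj₂ (there a)
  ... | inj₂ (here e) with ⇒-true (eval f A) (eval f B) e
  ...   | inj₁ e' = inj₁ (here e')
  ...   | inj₂ e' = inj₂ (here e')

  Valid-shiftL : ∀ {X} TL AL {Δ} → Valid ((X ∷ TL) ++ AL) Δ → Valid (TL ++ X ∷ AL) Δ
  Valid-shiftL TL AL v f with v f
  ... | inj₁ a = inj₁ (Any-resp-↭ (↭-sym (shift _ TL AL)) a)
  ... | inj₂ a = inj₂ a

  Valid-shiftR : ∀ {X Γ} TR AR → Valid Γ ((X ∷ TR) ++ AR) → Valid Γ (TR ++ X ∷ AR)
  Valid-shiftR TR AR v f with v f
  ... | inj₁ a = inj₁ a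
  ... | inj₂ a = inj₂ (Any-resp-↭ (↭-sym (shift _ TR AR)) a)

  -- TL, TR are still to be decomposed and AL, AR hold the atomic formulas set aside; the fuel n
  -- bounds the total size of TL and TR.
  mutual
    propositional : ∀ n TL TR AL AR → sizeAll TL + sizeAll TR ≤ n → All Atomic AL → All Atomic AR →
             Valid (TL ++ AL) (TR ++ AR) → Der (labelAll 0 (TL ++ AL)) (labelAll 0 (TR ++ AR))
    propositional n [] [] AL AR le aL aR v = atomicSequent AL AR aL aR v
    propositional zero (A ∷ TL) TR AL AR le aL aR v = ⊥-elim (noFuel A _ (≤-trans (m≤m+n _ (sizeAll TR)) le))
    propositional zero [] (A ∷ TR) AL AR le aL aR v = ⊥-elim (noFuel A _ le)
    propositional (suc n) ((A ∧ᶠ B) ∷ TL) TR AL AR le aL aR v =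
      dL∧ #0 (propositional n (A ∷ B ∷ TL) TR AL AR (fuel-L∧ (size A) (size B) (sizeAll TL) (sizeAll TR) le) aL aR (vL∧ v))
    propositional (suc n) ((A ∨ᶠ B) ∷ TL) TR AL AR le aL aR v =
      dL∨ #0 (propositional n (A ∷ TL) TR AL AR (fuel-L-left (size A) (size B) (sizeAll TL) (sizeAll TR) le) aL aR (vL∨₁ v))
                      (propositional n (B ∷ TL) TR AL AR (fuel-L-right (size A) (size B) (sizeAll TL) (sizeAll TR) le) aL aR (vL∨₂ v))
    propositional (suc n) ((A ⊃ B) ∷ TL) TR AL AR le aL aR v =
      dL⊃ #0 (propositional n TL (A ∷ TR) AL AR (fuel-L⊃₁ (size A) (size B) (sizeAll TL) (sizeAll TR) le) aL aR (vL⊃₁ v))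
                      (propositional n (B ∷ TL) TR AL AR (fuel-L-right (size A) (size B) (sizeAll TL) (sizeAll TR) le) aL aR (vL⊃₂ v))
    propositional (suc n) [] ((A ∧ᶠ B) ∷ TR) AL AR le aL aR v =
      dR∧ #0 (propositional n [] (A ∷ TR) AL AR (fuel-R-left (size A) (size B) (sizeAll TR) le) aL aR (vR∧₁ v))
                      (propositional n [] (B ∷ TR) AL AR (fuel-R-right (size A) (size B) (sizeAll TR) le) aL aR (vR∧₂ v))
    propositional (suc n) [] ((A ∨ᶠ B) ∷ TR) AL AR le aL aR v =
      dR∨ #0 (propositional n [] (A ∷ B ∷ TR) AL AR (fuel-R∨ (size A) (size B) (sizeAll TR) le) aL aR (vR∨ v))
    propositional (suc n) [] ((A ⊃ B) ∷ TR) AL AR le aL aR v =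
      dR⊃ #0 (propositional n (A ∷ []) (B ∷ TR) AL AR (fuel-R⊃ (size A) (size B) (sizeAll TR) le) aL aR (vR⊃ v))
    propositional (suc n) (atom p ∷ TL) TR AL AR le aL aR v = setAsideL n TL TR AL AR (isAtom p) le aL aR v
    propositional (suc n) (falsum ∷ TL) TR AL AR le aL aR v = setAsideL n TL TR AL AR isFalsum le aL aR v
    propositional (suc n) ((A > B) ∷ TL) TR AL AR le aL aR v = setAsideL n TL TR AL AR (isConditional A B) le aL aR v
    propositional (suc n) [] (atom p ∷ TR) AL AR le aL aR v = setAsideR n TR AL AR (isAtom p) le aL aR v
    propositional (suc n) [] (falsum ∷ TR) AL AR le aL aR v = setAsideR n TR AL AR isFalsum le aL aR v
    propositional (suc n) [] ((A > B) ∷ TR) AL AR le aL aR v = setAsideR n TR AL AR (isConditional A B) le aL aR v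

    setAsideL : ∀ n {X} TL TR AL AR → Atomic X → sizeAll (X ∷ TL) + sizeAll TR ≤ suc n → All Atomic AL → All Atomic AR →
                Valid ((X ∷ TL) ++ AL) (TR ++ AR) → Der (labelAll 0 ((X ∷ TL) ++ AL)) (labelAll 0 (TR ++ AR))
    setAsideL n {X} TL TR AL AR at le aL aR v =
      dPerm (propositional n TL TR (X ∷ AL) AR (fuel-atomL (size X) (sizeAll TL) (sizeAll TR) (size≥1 X) le)
                           (at ∷ aL) aR (Valid-shiftL TL AL v))
            (labelAll-shift X TL AL) ↭-refl

    setAsideR : ∀ n {X} TR AL AR → Atomic X → sizeAll [] + sizeAll (X ∷ TR) ≤ suc n → All Atomic AL → All Atomic AR →
                Valid AL (X ∷ TR ++ AR) → Der (labelAll 0 AL) (labelAll 0 (X ∷ TR ++ AR))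
    setAsideR n {X} TR AL AR at le aL aR v =
      dPerm (propositional n [] TR AL (X ∷ AR) (fuel-atomR (size X) (sizeAll TR) (size≥1 X) le)
                           aL (at ∷ aR) (Valid-shiftR TR AR v))
            ↭-refl (labelAll-shift X TR AR)

  tautology : ∀ A → Tautology A → Der [] (0 ∶ A ∷ [])
  tautology A t = propositional (sizeAll (A ∷ [])) [] (A ∷ []) [] [] ≤-refl [] [] (λ f → inj₂ (here (t f)))

  Thm : Formula → Set
  Thm A = Der [] (0 ∶ A ∷ [])

  -- Using a theorem inside a derivation, as needed for modus ponens and the rules RCEA, RCK,
  -- is where cut admissibility enters.
  applyImp : ∀ {A B} → Thm (A ⊃ B) → ∀ y {Γ Δ} → (y ∶ A) ∈ Γ → (y ∶ B) ∈ Δ → Der Γ Δ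
  applyImp {A} {B} t y {Γ} {Δ} m1 m2 =
    dCut (y ∶ (A ⊃ B)) (dWk Γ Δ (dRen (allWorldsTo y) t))
         (dL⊃ #0 (identity A m1 #0) (identity B #0 m2))

  modusPonens : ∀ {A B} → Thm A → Thm (A ⊃ B) → Thm B
  modusPonens {A} {B} d1 d2 = dCut (0 ∶ A) (dWk [] (0 ∶ B ∷ []) d1) (applyImp d2 0 #0 #0)

  iff→ : ∀ {A B} → Thm (A ↔ᶠ B) → Thm (A ⊃ B)
  iff→ {A} {B} d = dCut (0 ∶ (A ↔ᶠ B)) (dWk [] (0 ∶ (A ⊃ B) ∷ []) d) (dL∧ #0 (identity⊃ A B #0 #0))

  iff← : ∀ {A B} → Thm (A ↔ᶠ B) → Thm (B ⊃ A)
  iff← {A} {B} d = dCut (0 ∶ (A ↔ᶠ B)) (dWk [] (0 ∶ (B ⊃ A) ∷ []) d) (dL∧ #0 (identity⊃ B A #1 #0))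

  axID : ∀ A → Thm (A > A)
  axID A = dR> #0 (λ k → dRef (nv k) (dR∣ #1 #0 #0 (identity∃ A #2 #0) (dR∀ #0 (λ y → dR⊃ #0 (identity A #0 #0)))))

  axRAnd : ∀ A B C → Thm (((A > B) ∧ᶠ (A > C)) ⊃ (A > (B ∧ᶠ C)))
  axRAnd A B C =
    dR⊃ #0 $ dL∧ #0 $ dR> #0 λ k →
      dL> #0 #2 (identity∃ A #1 #0) $ dL∣ #0 λ c →
        dL> #0 #7 (identity∃ A #2 #0) $ dL∣ #0 λ d →
          dTr #1 #5 $ dR∣ #1 #0 #0 (identity∃ A #3 #0) $ dR∀ #0 λ y →
            dL⊆ #0 #3 $ dL∀ #0 #10 $ dL∀ #2 #7 $ dR⊃ #0 $
              dR∧ #0 (dL⊃ #2 (identity A #0 #0) (identity B #0 #0))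
                     (dL⊃ #1 (identity A #0 #0) (identity C #0 #0))

  axCM : ∀ A B C → Thm (((A > B) ∧ᶠ (A > C)) ⊃ ((A ∧ᶠ B) > C))
  axCM A B C =
    dR⊃ #0 $ dL∧ #0 $ dR> #0 λ k →
      dL> #0 #2 (dL∃ #1 (λ y → dR∃ #0 #0 (dL∧ #1 (identity A #0 #0)))) $ dL∣ #0 λ c →
        dL> #0 #7 (identity∃ A #2 #0) $ dL∣ #0 λ d →
          dTr #1 #5 $ dR∣ #1 #0 #0
            (dL∃ #3 λ y → dR∃ #0 #0 $ dL⊆ #0 #4 $ dL∀ #0 #10 $
               dR∧ #0 (identity A #3 #0) (dL⊃ #0 (identity A #2 #0) (identity B #0 #0)))
            (dR∀ #0 λ y → dL∀ #0 #5 $ dR⊃ #0 $ dL∧ #0 $ dL⊃ #2 (identity A #0 #0) (identity C #0 #0))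

  axOR : ∀ A B C → Thm (((A > C) ∧ᶠ (B > C)) ⊃ ((A ∨ᶠ B) > C))
  axOR A B C =
    dR⊃ #0 $ dL∧ #0 $ dR> #0 λ k → dL∃ #1 λ y → dL∨ #1 caseA caseB
    where
      caseA : ∀ {k y} → Der (y ∶ A ∷ y ∈ₗ nv k ∷ nv k ∈N 0 ∷ 0 ∶ (A > C) ∷ 0 ∶ (B > C) ∷ [])
                              (0 ⊩[ nv k ] (A ∨ᶠ B) ∣ C ∷ [])
      caseA = dL> #2 #3 (dR∃ #1 #0 (identity A #0 #0)) $ dL∣ #0 λ c →
        dL> #0 #8
          (dR∣ #0 #1 #1
            (dL∃ #2 λ z → dR∃ #0 #0 $ dR∨ #0 (identity A #1 #0))
            (dR∀ #0 λ z → dR⊃ #0 $ dL∨ #0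
               (dL∀ #1 #5 $ dL⊃ #0 (identity A #0 #0) (identity C #0 #0))
               (dR∃ #1 #1 (identity B #0 #0))))
          (dL∣ #0 λ d → dTr #1 #5 $ dR∣ #1 #0 #0
            (dL∃ #3 λ z → dR∃ #0 #0 $ dR∨ #0 (identity B #1 #1))
            (dR∀ #0 λ z → dR⊃ #0 $ dL∨ #0
               (dL⊆ #1 #4 $ dL∀ #0 #11 $ dL⊃ #0 (identity A #1 #0) (identity C #0 #0))
               (dL∀ #1 #6 $ dL⊃ #0 (identity B #0 #0) (identity C #0 #0))))
      caseB : ∀ {k y} → Der (y ∶ B ∷ y ∈ₗ nv k ∷ nv k ∈N 0 ∷ 0 ∶ (A > C) ∷ 0 ∶ (B > C) ∷ [])
                              (0 ⊩[ nv k ] (A ∨ᶠ B) ∣ C ∷ [])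
      caseB = dL> #2 #4 (dR∃ #1 #0 (identity B #0 #0)) $ dL∣ #0 λ c →
        dL> #0 #7
          (dR∣ #0 #1 #1
            (dL∃ #2 λ z → dR∃ #0 #0 $ dR∨ #0 (identity B #1 #1))
            (dR∀ #0 λ z → dR⊃ #0 $ dL∨ #0
               (dR∃ #1 #1 (identity A #0 #0))
               (dL∀ #1 #5 $ dL⊃ #0 (identity B #0 #0) (identity C #0 #0))))
          (dL∣ #0 λ d → dTr #1 #5 $ dR∣ #1 #0 #0
            (dL∃ #3 λ z → dR∃ #0 #0 $ dR∨ #0 (identity A #1 #0))
            (dR∀ #0 λ z → dR⊃ #0 $ dL∨ #0
               (dL∀ #1 #6 $ dL⊃ #0 (identity A #0 #0) (identity C #0 #0))
               (dL⊆ #1 #4 $ dL∀ #0 #11 $ dL⊃ #0 (identity B #1 #0) (identity C #0 #0))))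

  axN : 1 ≤ rank (level L) → Thm (¬ᶠ (verum > falsum))
  axN h = dR⊃ #0 $ dN h 0 λ k →
    dL> #0 #1 (d0 h #0 λ y → dR∃ #0 #0 (dR⊃ #0 (dInit⊥ #0))) $
    dL∣ #0 λ c → dL∃ #2 λ y → dL∀ #0 #4 $ dL⊃ #0 (dR⊃ #0 (dInit⊥ #0)) (dInit⊥ #0)

  axT : ∀ A → 2 ≤ rank (level L) → Thm (A ⊃ ¬ᶠ (A > falsum))
  axT A h = dR⊃ #0 $ dR⊃ #0 $ dT h 0 λ k →
    dL> #1 #2 (dR∃ #0 #0 (identity A #3 #0)) $
    dL∣ #0 λ c → dL∃ #2 λ y → dL∀ #0 #4 $ dL⊃ #0 (identity A #1 #0) (dInit⊥ #0)

  axW : ∀ A B → 3 ≤ rank (level L) → Thm ((A > B) ⊃ (A ⊃ B))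
  axW A B h = dR⊃ #0 $ dR⊃ #0 $ dN (≤-trans (s≤s z≤n) h) 0 λ k → dW h #0 $
    dL> #1 #3 (dR∃ #0 #0 (identity A #2 #0)) $
    dL∣ #0 λ c → dW h #0 $ dL∀ #0 #4 $ dL⊃ #0 (identity A #7 #0) (identity B #0 #0)

  axU₁ : ∀ A → suffix L ≡ sU → Thm (((¬ᶠ A) > falsum) ⊃ ((¬ᶠ ((¬ᶠ A) > falsum)) > falsum))
  axU₁ A h = dR⊃ #0 $ dR> #0 λ k → dL∃ #1 λ y →
    dL⊃ #1
      (dR> #0 λ b → dL∃ #1 λ z → dU₁ h #4 #3 #2 #0 λ c →
         dL> #1 #7 (dR∃ #0 #0 (identity (¬ᶠ A) #3 #0)) $
         dL∣ #0 λ d → dL∃ #2 λ w → dL∀ #0 #4 $ dL⊃ #0 (identity (¬ᶠ A) #1 #0) (dInit⊥ #0))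
      (dInit⊥ #0)

  axU₂ : ∀ A → suffix L ≡ sU → Thm ((¬ᶠ (A > falsum)) ⊃ ((A > falsum) > falsum))
  axU₂ A h = dR⊃ #0 $ dL⊃ #0
    (dR> #0 λ k → dR> #1 λ j → dL∃ #1 λ y → dL∃ #4 λ z → dU₂ h #4 #2 #5 #0 λ c →
       dL> #1 #5 (dR∃ #0 #0 (identity A #3 #0)) $
       dL∣ #0 λ d → dL∃ #2 λ w → dL∀ #0 #4 $ dL⊃ #0 (identity A #1 #0) (dInit⊥ #0))
    (dInit⊥ #0)

  axA₁ : ∀ A B C → suffix L ≡ sA → Thm ((A > B) ⊃ (C > (A > B)))
  axA₁ A B C h = dR⊃ #0 $ dR> #0 λ k → dRef (nv k) $ dR∣ #1 #0 #0 (identity∃ C #2 #0) $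
    dR∀ #0 λ y → dR⊃ #0 $ dR> #0 λ b → dA₂ h #5 #3 #0 $
    dL> #0 #8 (identity∃ A #2 #0) $ dL∣ #0 λ c → dA₁ h #10 #8 #0 $
    dR∣ #0 #2 #0 (identity∃ A #3 #0) (identity∀⊃ A B #4 #0)

  axA₂ : ∀ A B C → suffix L ≡ sA → Thm ((¬ᶠ (A > B)) ⊃ (C > (¬ᶠ (A > B))))
  axA₂ A B C h = dR⊃ #0 $ dL⊃ #0
    (dR> #1 λ k → dRef (nv k) $ dR∣ #1 #0 #0 (identity∃ C #2 #0) $
       dR∀ #0 λ y → dR⊃ #0 $ dR⊃ #0 $ dR> #2 λ b → dA₁ h #6 #4 #0 $
       dL> #0 #3 (identity∃ A #2 #0) $ dL∣ #0 λ c → dA₂ h #11 #9 #0 $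
       dR∣ #0 #2 #0 (identity∃ A #3 #0) (identity∀⊃ A B #4 #0))
    (dInit⊥ #0)

  ∈-remove : ∀ {φ ψ : LFormula} {Γ} (m : φ ∈ Γ) → ψ ∈ Γ → ¬ ψ ≡ φ → ψ ∈ Γ ─ m
  ∈-remove #0 #0 ne = ⊥-elim (ne refl)
  ∈-remove #0 (there m') ne = m'
  ∈-remove (there m) #0 ne = here refl
  ∈-remove (there m) (there m') ne = there (∈-remove m m' ne)

  -- The replacement rules, stated for atoms, extend to arbitrary formulas.
  mutual
    repl₁ : ∀ B {x y Γ Δ} → level L ≡ lC → (y ∈ₗ sng x) ∈ Γ → (x ∶ B) ∈ Γ → (y ∶ B) ∈ Δ → Der Γ Δ
    repl₁ (atom p) h m1 m2 m3 = dRepl₁ (atP p) h m1 m2 (dInit #0 m3)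
    repl₁ falsum h m1 m2 m3 = dInit⊥ m2
    repl₁ (B ∧ᶠ C) h m1 m2 m3 =
      dL∧ m2 (dR∧ m3 (repl₁ B h (there (there (∈-remove m2 m1 λ ()))) #0 #0) (repl₁ C h (there (there (∈-remove m2 m1 λ ()))) #1 #0))
    repl₁ (B ∨ᶠ C) h m1 m2 m3 =
      dR∨ m3 (dL∨ m2 (repl₁ B h (there (∈-remove m2 m1 λ ())) #0 #0) (repl₁ C h (there (∈-remove m2 m1 λ ())) #0 #1))
    repl₁ (B ⊃ C) h m1 m2 m3 =
      dR⊃ m3 (dL⊃ (there m2) (repl₂ B h (there (∈-remove m2 m1 λ ())) #0 #0) (repl₁ C h (there (there (∈-remove m2 m1 λ ()))) #0 #0))
    repl₁ (B > C) h m1 m2 m3 =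
      dR> m3 λ k → dRepl₂ (atNb (nv k)) h (there (there m1)) #0 $
      dL> #0 (there (there (there m2))) (identity∃ B #2 #0) $ dL∣ #0 λ c →
      dRepl₁ (atNb (nv c)) h (there (there (there (there (there (there (there m1))))))) #0 $
      dR∣ #0 #2 #0 (identity∃ B #3 #0) (identity∀⊃ B C #4 #0)

    repl₂ : ∀ B {x y Γ Δ} → level L ≡ lC → (y ∈ₗ sng x) ∈ Γ → (y ∶ B) ∈ Γ → (x ∶ B) ∈ Δ → Der Γ Δ
    repl₂ (atom p) h m1 m2 m3 = dRepl₂ (atP p) h m1 m2 (dInit #0 m3)
    repl₂ falsum h m1 m2 m3 = dInit⊥ m2
    repl₂ (B ∧ᶠ C) h m1 m2 m3 =
      dL∧ m2 (dR∧ m3 (repl₂ B h (there (there (∈-remove m2 m1 λ ()))) #0 #0) (repl₂ C h (there (there (∈-remove m2 m1 λ ()))) #1 #0))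
    repl₂ (B ∨ᶠ C) h m1 m2 m3 =
      dR∨ m3 (dL∨ m2 (repl₂ B h (there (∈-remove m2 m1 λ ())) #0 #0) (repl₂ C h (there (∈-remove m2 m1 λ ())) #0 #1))
    repl₂ (B ⊃ C) h m1 m2 m3 =
      dR⊃ m3 (dL⊃ (there m2) (repl₁ B h (there (∈-remove m2 m1 λ ())) #0 #0) (repl₂ C h (there (there (∈-remove m2 m1 λ ()))) #0 #0))
    repl₂ (B > C) h m1 m2 m3 =
      dR> m3 λ k → dRepl₁ (atNb (nv k)) h (there (there m1)) #0 $
      dL> #0 (there (there (there m2))) (identity∃ B #2 #0) $ dL∣ #0 λ c →
      dRepl₂ (atNb (nv c)) h (there (there (there (there (there (there (there m1))))))) #0 $
      dR∣ #0 #2 #0 (identity∃ B #3 #0) (identity∀⊃ B C #4 #0)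

  axC : ∀ A B → level L ≡ lC → Thm ((A ∧ᶠ B) ⊃ (A > B))
  axC A B h = dR⊃ #0 $ dL∧ #0 $ dR> #0 λ k → dC h #0 $ dR∣ #0 #1 #0
    (dSingle h #0 $ dR∃ #0 #0 (identity A #5 #0))
    (dR∀ #0 λ y → dR⊃ #0 $ repl₁ B h #1 #7 #0)

  rceaHalf : ∀ {A B} C → Thm (A ⊃ B) → Thm (B ⊃ A) → Thm ((A > C) ⊃ (B > C))
  rceaHalf C ab ba = dR⊃ #0 $ dR> #0 λ k →
    dL> #0 #2 (dL∃ #1 λ y → dR∃ #0 #0 (applyImp ba y #1 #0)) $
    dL∣ #0 λ c → dR∣ #0 #1 #0
      (dL∃ #2 λ z → dR∃ #0 #0 (applyImp ab z #1 #0))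
      (dR∀ #0 λ z → dL∀ #0 #4 $ dR⊃ #0 $ dL⊃ #1 (applyImp ba z #0 #0) (identity C #0 #0))

  ruleRCEA : ∀ {A B C} → Thm (A ↔ᶠ B) → Thm ((A > C) ↔ᶠ (B > C))
  ruleRCEA {C = C} d = dR∧ #0 (rceaHalf C (iff→ d) (iff← d)) (rceaHalf C (iff← d) (iff→ d))

  ruleRCK : ∀ {A B C} → Thm (A ⊃ B) → Thm ((C > A) ⊃ (C > B))
  ruleRCK {C = C} ab = dR⊃ #0 $ dR> #0 λ k → dL> #0 #2 (identity∃ C #1 #0) $ dL∣ #0 λ j →
    dR∣ #0 #1 #0 (identity∃ C #2 #0) $ dR∀ #0 λ y → dL∀ #0 #4 $ dR⊃ #0 $
    dL⊃ #1 (identity C #0 #0) (applyImp ab y #0 #0)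

  hilbert⇒Thm : ∀ {A} → ⊢ᴴ L ∣ A → Thm A
  hilbert⇒Thm (taut t) = tautology _ t
  hilbert⇒Thm (mp d1 d2) = modusPonens (hilbert⇒Thm d1) (hilbert⇒Thm d2)
  hilbert⇒Thm (rcea d) = ruleRCEA (hilbert⇒Thm d)
  hilbert⇒Thm (rck d) = ruleRCK (hilbert⇒Thm d)
  hilbert⇒Thm ax-ID = axID _
  hilbert⇒Thm ax-RAnd = axRAnd _ _ _
  hilbert⇒Thm ax-CM = axCM _ _ _
  hilbert⇒Thm ax-OR = axOR _ _ _
  hilbert⇒Thm (ax-N h) = axN h
  hilbert⇒Thm (ax-T h) = axT _ h
  hilbert⇒Thm (ax-W h) = axW _ _ h
  hilbert⇒Thm (ax-C h) = axC _ _ h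
  hilbert⇒Thm (ax-U₁ h) = axU₁ _ h
  hilbert⇒Thm (ax-U₂ h) = axU₂ _ h
  hilbert⇒Thm (ax-A₁ h) = axA₁ _ _ _ h
  hilbert⇒Thm (ax-A₂ h) = axA₂ _ _ _ h

mainTheorem13 : (L : Logic) (A : Formula) → ⊢ᴴ L ∣ A →
                (x : ℕ) → L ⊢ [] ⇒ (x ∶ A) ∷ []
mainTheorem13 L A h x = toCalculus L (proj₂ (dRen L (allWorldsTo x) (hilbert⇒Thm L h)))
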